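{- Let $k \geq 2$ be a natural number and let $F$ be an undirected forest on $n \geq 2$ vertices. Then $\psi_b(F,k) \geq \frac{n+3k-1}{2k}$. Moreover, this lower bound is tight: whenever $n \geq 2$ is such that $\frac{n+3k-1}{2k}$ is an integer, there exists an undirected forest $F$ on $n$ vertices with $\psi_b(F,k) = \frac{n+3k-1}{2k}$.
   Context: For an undirected forest $F$, a leaf is a vertex of degree $1$, an isolated vertex is a vertex of degree $0$, and a branching vertex is a vertex of degree at least $3$. A path on $k$ vertices is a path of length $k-1$. A set $P$ of vertices of $F$ is a branching $k$-path vertex cover of $F$ if every vertex of degree at most $1$ (leaves and isolated vertices) belongs to $P$ and every path on $k$ vertices in $F$ contains a branching vertex or a vertex of $P$. The branching $k$-path vertex cover number $\psi_b(F,k)$ is the minimum size of a branching $k$-path vertex cover of $F$. -}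

module Defs where

open import Data.Nat using (ℕ; zero; suc; _≤_; _*_; _+_; _∸_)
open import Data.Bool using (Bool; true; false; if_then_else_)
open import Data.Fin using (Fin; toℕ)
open import Data.Fin.Subset using (Subset; _∈_; ∣_∣; inside; outside)
open import Data.Vec using (tabulate)
open import Data.Product using (Σ; ∃; _×_)
open import Data.Sum using (_⊎_)
open import Function.Definitions using (Injective)
open import Relation.Binary.PropositionalEquality using (_≡_)
open import Relation.Nullary using (¬_)

record Graph (n : ℕ) : Set where
  field
    adj       : Fin n → Fin n → Bool
    adj-sym   : ∀ u v → adj u v ≡ adj v u
    adj-irrefl : ∀ v → adj v v ≡ false
open Graph public

Adj : ∀ {n} → Graph n → Fin n → Fin n → Set
Adj G u v = adj G u v ≡ true

nbhd : ∀ {n} → Graph n → Fin n → Subset n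
nbhd G v = tabulate (λ u → if adj G v u then inside else outside)

degree : ∀ {n} → Graph n → Fin n → ℕ
degree G v = ∣ nbhd G v ∣

Branching : ∀ {n} → Graph n → Fin n → Set
Branching G v = 3 ≤ degree G v

IsPath : ∀ {n} → Graph n → (m : ℕ) → (Fin m → Fin n) → Set
IsPath G m p =
  Injective _≡_ _≡_ p ×
  (∀ (i j : Fin m) → toℕ j ≡ suc (toℕ i) → Adj G (p i) (p j))

IsCycle : ∀ {n} → Graph n → (m : ℕ) → (Fin m → Fin n) → Set
IsCycle G m p =
  3 ≤ m × IsPath G m p ×
  (∀ (i j : Fin m) → suc (toℕ i) ≡ m → toℕ j ≡ 0 → Adj G (p i) (p j))

IsForest : ∀ {n} → Graph n → Set
IsForest {n} G = ∀ (m : ℕ) (p : Fin m → Fin n) → ¬ IsCycle G m p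

IsBranchingPathCover : ∀ {n} → Graph n → ℕ → Subset n → Set
IsBranchingPathCover {n} G k P =
  (∀ (v : Fin n) → degree G v ≤ 1 → v ∈ P) ×
  (∀ (p : Fin k → Fin n) → IsPath G k p →
     Σ (Fin k) (λ i → Branching G (p i) ⊎ p i ∈ P))

ψb-≥ : ∀ {n} → Graph n → ℕ → ℕ → Set
ψb-≥ {n} G k m = ∀ (P : Subset n) → IsBranchingPathCover G k P → m ≤ ∣ P ∣

ψb-≡ : ∀ {n} → Graph n → ℕ → ℕ → Set
ψb-≡ {n} G k m =
  Σ (Subset n) (λ P → IsBranchingPathCover G k P × ∣ P ∣ ≡ m) × ψb-≥ G k m

-- Call a vertex blocking if it is in P or branching, and free otherwise.  Free vertices have
-- degree 2, and a path of free vertices has fewer than k vertices; growing layers outwards from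
-- the blocking vertices, each layer has at most e(free, blocking) vertices and only ⌊(k - 1)/2⌋
-- layers fit (plus half a layer when k is even), so 2·#free ≤ (k - 1)·e(free, blocking).
-- Summing a per-vertex inequality that is tight at free vertices, and using that a forest with
-- an edge has Σ deg + 2·#isolated ≤ 2n - 2, gives 2n + 2(3k - 1) ≤ 4k·|P|.
-- Equality holds for caterpillars in which every free segment has k - 1 vertices: numbering
-- them so that the leaves and branching vertices are exactly the multiples of k, a k-path
-- avoiding them would run through k consecutive numbers.
module Submission where

open import Data.Bool using (Bool; true; false; _∧_; _∨_; not; if_then_else_)
import Data.Bool as Bool
open import Data.Bool.Properties using (∧-conical; ∨-conical; ∧-identityʳ; ∧-zeroʳ; ∨-zeroʳ; ∨-comm; not-injective)
open import Data.Fin as Fin using (Fin; zero; suc; toℕ; fromℕ<; inject₁; punchIn; punchOut)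
open import Data.Fin.Properties
  using (toℕ<n; toℕ-injective; toℕ-fromℕ<; toℕ-fromℕ; toℕ-inject₁; any?; pigeonhole; punchIn-punchOut; punchOut-injective)
import Data.Fin.Properties as Finₚ
open import Data.Fin.Subset using (Subset; _∈_; ∣_∣; ⊤)
open import Data.Fin.Subset.Properties using (p⊆q⇒∣p∣≤∣q∣; ∣⊤∣≡n)
open import Data.List using (_∷_; [])
open import Data.Nat
open import Data.Nat.Divisibility
open import Data.Nat.Properties
open import Algebra.Properties.Semiring.Sum +-*-semiring
  using (sum; sum-syntax; sum-cong-≗; ∑-distrib-+; ∑-comm; *-distribˡ-sum; sum-remove; sum-init-last)
open import Data.Nat.Tactic.RingSolver using (solve; solve-∀)
open import Data.Product
open import Data.Sum using (_⊎_; inj₁; inj₂)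
import Data.Vec as Vec
open import Data.Vec using (lookup; tabulate)
open import Data.Vec.Properties using (lookup∘tabulate; lookup⇒[]=; []=⇒lookup)
open import Function using (_∘_)
open import Function.Definitions using (Injective)
open import Relation.Binary.Definitions using (tri<; tri≈; tri>)
open import Relation.Binary.PropositionalEquality
open import Relation.Nullary
open import Relation.Nullary.Decidable using (dec-true; dec-false; _×-dec_; _⊎-dec_)
open import Relation.Unary using (Decidable)
open import Defs

-- Sums of indicators

⟦_⟧ : Bool → ℕ
⟦ true ⟧ = 1
⟦ false ⟧ = 0

does⇒ : ∀ {a} {A : Set a} (a? : Dec A) → does a? ≡ true → A
does⇒ (yes a) _ = a
does⇒ (no _) ()

⟦x∧y⟧≤⟦y⟧ : ∀ x y → ⟦ x ∧ y ⟧ ≤ ⟦ y ⟧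
⟦x∧y⟧≤⟦y⟧ true y = ≤-refl
⟦x∧y⟧≤⟦y⟧ false y = z≤n

∣p∣≡∑⟦p⟧ : ∀ {n} (p : Subset n) → ∣ p ∣ ≡ ∑[ i < n ] ⟦ lookup p i ⟧
∣p∣≡∑⟦p⟧ Vec.[] = refl
∣p∣≡∑⟦p⟧ (true Vec.∷ p) = cong suc (∣p∣≡∑⟦p⟧ p)
∣p∣≡∑⟦p⟧ (false Vec.∷ p) = ∣p∣≡∑⟦p⟧ p

sum-const : ∀ n c → ∑[ i < n ] c ≡ n * c
sum-const zero c = refl
sum-const (suc n) c = cong (c +_) (sum-const n c)

sum-mono-≤ : ∀ {n} {f g : Fin n → ℕ} → (∀ i → f i ≤ g i) → sum f ≤ sum g
sum-mono-≤ {zero} f≤g = z≤n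
sum-mono-≤ {suc n} f≤g = +-mono-≤ (f≤g zero) (sum-mono-≤ (λ i → f≤g (suc i)))

0<sum⇒∃0< : ∀ {n} (f : Fin n → ℕ) → 0 < sum f → ∃ λ i → 0 < f i
0<sum⇒∃0< {suc n} f 0<s with f zero in eq
... | suc _ = zero , subst (0 <_) (sym eq) (s≤s z≤n)
... | zero with 0<sum⇒∃0< (λ i → f (suc i)) 0<s
...   | i , 0<fi = suc i , 0<fi

∑-injective-≤ : ∀ {m n} (f : Fin n → ℕ) (e : Fin m → Fin n) → Injective _≡_ _≡_ e →
                ∑[ j < m ] f (e j) ≤ sum f
∑-injective-≤ {zero} f e e-inj = z≤n
∑-injective-≤ {suc m} {zero} f e e-inj with e zero
... | ()
∑-injective-≤ {suc m} {suc n} f e e-inj = begin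
  f (e zero) + ∑[ j < m ] f (e (suc j))
    ≡⟨ cong (f (e zero) +_) (sum-cong-≗ (λ j → cong f (sym (punchIn-punchOut (e≢e₀ j))))) ⟩
  f (e zero) + ∑[ j < m ] f (punchIn (e zero) (e′ j))
    ≤⟨ +-monoʳ-≤ (f (e zero)) (∑-injective-≤ (λ i → f (punchIn (e zero) i)) e′ e′-inj) ⟩
  f (e zero) + ∑[ i < n ] f (punchIn (e zero) i)
    ≡⟨ sym (sum-remove f) ⟩
  sum f ∎
  where
  open ≤-Reasoning
  e≢e₀ : ∀ j → e zero ≢ e (suc j)
  e≢e₀ j eq with e-inj eq
  ... | ()
  e′ : Fin m → Fin n
  e′ j = punchOut (e≢e₀ j)
  e′-inj : Injective _≡_ _≡_ e′
  e′-inj {i} {j} eq = Finₚ.suc-injective (e-inj (punchOut-injective (e≢e₀ i) (e≢e₀ j) eq))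

sum-mono-≤-at : ∀ {n} {f g : Fin n → ℕ} (x : Fin n) {d} →
                (∀ i → f i ≤ g i) → f x + d ≤ g x → sum f + d ≤ sum g
sum-mono-≤-at {f = f} zero {d} f≤g fx+d≤gx = begin
  f zero + sum (λ i → f (suc i)) + d ≡⟨ +-assoc (f zero) _ d ⟩
  f zero + (sum (λ i → f (suc i)) + d) ≡⟨ cong (f zero +_) (+-comm _ d) ⟩
  f zero + (d + sum (λ i → f (suc i))) ≡⟨ sym (+-assoc (f zero) d _) ⟩
  f zero + d + sum (λ i → f (suc i)) ≤⟨ +-mono-≤ fx+d≤gx (sum-mono-≤ (λ i → f≤g (suc i))) ⟩
  _ ∎
  where open ≤-Reasoning
sum-mono-≤-at {f = f} (suc x) {d} f≤g fx+d≤gx = begin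
  f zero + sum (λ i → f (suc i)) + d ≡⟨ +-assoc (f zero) _ d ⟩
  f zero + (sum (λ i → f (suc i)) + d) ≤⟨ +-mono-≤ (f≤g zero) (sum-mono-≤-at x (λ i → f≤g (suc i)) fx+d≤gx) ⟩
  _ ∎
  where open ≤-Reasoning

sum-single : ∀ {n} (f : Fin n → ℕ) (x : Fin n) → (∀ i → i ≢ x → f i ≡ 0) → sum f ≡ f x
sum-single {suc n} f zero f≡0 = begin
  f zero + sum (λ i → f (suc i)) ≡⟨ cong (f zero +_) (sum-cong-≗ (λ i → f≡0 (suc i) (λ ()))) ⟩
  f zero + ∑[ i < n ] 0          ≡⟨ cong (f zero +_) (trans (sum-const n 0) (*-zeroʳ n)) ⟩
  f zero + 0                     ≡⟨ +-identityʳ (f zero) ⟩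
  f zero                         ∎
  where open ≡-Reasoning
sum-single {suc n} f (suc x) f≡0 = begin
  f zero + sum (λ i → f (suc i)) ≡⟨ cong (_+ sum (λ i → f (suc i))) (f≡0 zero (λ ())) ⟩
  sum (λ i → f (suc i))          ≡⟨ sum-single (λ i → f (suc i)) x (λ i i≢x → f≡0 (suc i) (λ eq → i≢x (Finₚ.suc-injective eq))) ⟩
  f (suc x)                      ∎
  where open ≡-Reasoning

≤-sum : ∀ {n} (f : Fin n → ℕ) (i : Fin n) → f i ≤ sum f
≤-sum {suc n} f i = subst (f i ≤_) (sym (sum-remove f)) (m≤m+n (f i) _)

injective-positive⇒≤sum : ∀ {m n} (f : Fin n → ℕ) (e : Fin m → Fin n) → Injective _≡_ _≡_ e →
                          (∀ j → 0 < f (e j)) → m ≤ sum f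
injective-positive⇒≤sum {m} f e e-inj 0<f = begin
  m                     ≡⟨ sym (*-identityʳ m) ⟩
  m * 1                 ≡⟨ sym (sum-const m 1) ⟩
  ∑[ j < m ] 1          ≤⟨ sum-mono-≤ 0<f ⟩
  ∑[ j < m ] f (e j)    ≤⟨ ∑-injective-≤ f e e-inj ⟩
  sum f                 ∎
  where open ≤-Reasoning

sum-update : ∀ {n} {f g : Fin n → ℕ} (x : Fin n) → (∀ i → i ≢ x → f i ≡ g i) →
             sum f + g x ≡ sum g + f x
sum-update {suc n} {f} {g} zero f≡g = begin
  f zero + sum (λ i → f (suc i)) + g zero ≡⟨ cong (λ s → f zero + s + g zero) (sum-cong-≗ λ i → f≡g (suc i) λ ()) ⟩
  f zero + sum (λ i → g (suc i)) + g zero ≡⟨ +-comm (f zero + _) (g zero) ⟩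
  g zero + (f zero + sum (λ i → g (suc i))) ≡⟨ cong (g zero +_) (+-comm (f zero) _) ⟩
  g zero + (sum (λ i → g (suc i)) + f zero) ≡⟨ sym (+-assoc (g zero) _ (f zero)) ⟩
  g zero + sum (λ i → g (suc i)) + f zero ∎
  where open ≡-Reasoning
sum-update {suc n} {f} {g} (suc x) f≡g = begin
  f zero + sum (λ i → f (suc i)) + g (suc x) ≡⟨ +-assoc (f zero) _ (g (suc x)) ⟩
  f zero + (sum (λ i → f (suc i)) + g (suc x)) ≡⟨ cong₂ _+_ (f≡g zero λ ()) (sum-update x λ i i≢x → f≡g (suc i) (i≢x ∘ Finₚ.suc-injective)) ⟩
  g zero + (sum (λ i → g (suc i)) + f (suc x)) ≡⟨ sym (+-assoc (g zero) _ (f (suc x))) ⟩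
  g zero + sum (λ i → g (suc i)) + f (suc x) ∎
  where open ≡-Reasoning

sum-update₂ : ∀ {n} {f g : Fin n → ℕ} {x y : Fin n} → x ≢ y → (∀ i → i ≢ x → i ≢ y → f i ≡ g i) →
              sum f + (g x + g y) ≡ sum g + (f x + f y)
sum-update₂ {n} {f} {g} {x} {y} x≢y f≡g = begin
  sum f + (g x + g y) ≡⟨ sym (+-assoc (sum f) (g x) (g y)) ⟩
  sum f + g x + g y   ≡⟨ cong (_+ g y) (trans (cong (sum f +_) (sym h-at-x)) (sum-update {f = f} {g = h} x f≡h)) ⟩
  sum h + f x + g y   ≡⟨ +-assoc (sum h) (f x) (g y) ⟩
  sum h + (f x + g y) ≡⟨ cong (sum h +_) (+-comm (f x) (g y)) ⟩
  sum h + (g y + f x) ≡⟨ sym (+-assoc (sum h) (g y) (f x)) ⟩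
  sum h + g y + f x   ≡⟨ cong (_+ f x) (sum-update {f = h} {g = g} y h≡g) ⟩
  sum g + h y + f x   ≡⟨ cong (λ z → sum g + z + f x) (h-off-x y (x≢y ∘ sym)) ⟩
  sum g + f y + f x   ≡⟨ +-assoc (sum g) (f y) (f x) ⟩
  sum g + (f y + f x) ≡⟨ cong (sum g +_) (+-comm (f y) (f x)) ⟩
  sum g + (f x + f y) ∎
  where
  open ≡-Reasoning
  h : Fin n → ℕ
  h i = if does (i Fin.≟ x) then g i else f i
  h-at-x : h x ≡ g x
  h-at-x rewrite dec-true (x Fin.≟ x) refl = refl
  h-off-x : ∀ i → i ≢ x → h i ≡ f i
  h-off-x i i≢x rewrite dec-false (i Fin.≟ x) i≢x = refl
  f≡h : ∀ i → i ≢ x → f i ≡ h i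
  f≡h i i≢x = sym (h-off-x i i≢x)
  h≡g : ∀ i → i ≢ y → h i ≡ g i
  h≡g i i≢y with i Fin.≟ x
  ... | yes _ = refl
  ... | no i≢x = f≡g i i≢x i≢y

-- Degrees and edge counts

module _ {n : ℕ} (G : Graph n) where

  Adj-sym : ∀ {u v} → Adj G u v → Adj G v u
  Adj-sym {u} {v} a = trans (adj-sym G v u) a

  Adj⇒≢ : ∀ {u v} → Adj G u v → u ≢ v
  Adj⇒≢ {u} a refl with trans (sym a) (adj-irrefl G u)
  ... | ()

  AdjIn : (Fin n → Bool) → Fin n → Fin n → Set
  AdjIn A v u = Adj G v u × A u ≡ true

  degreeIn : (Fin n → Bool) → Fin n → ℕ
  degreeIn A v = ∑[ u < n ] ⟦ A u ∧ adj G v u ⟧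

  degree≡degreeIn-all : ∀ v → degree G v ≡ degreeIn (λ _ → true) v
  degree≡degreeIn-all v = trans (∣p∣≡∑⟦p⟧ (nbhd G v)) (sum-cong-≗ λ u →
    cong ⟦_⟧ (trans (lookup∘tabulate _ u) (if-true-false (adj G v u))))
    where
    if-true-false : ∀ b → (if b then true else false) ≡ b
    if-true-false true = refl
    if-true-false false = refl

  AdjIn⇒⟦⟧≡1 : ∀ A {v u} → AdjIn A v u → ⟦ A u ∧ adj G v u ⟧ ≡ 1
  AdjIn⇒⟦⟧≡1 A (a , Au) rewrite Au | a = refl

  AdjIn⇒0<degreeIn : ∀ A {v u} → AdjIn A v u → 0 < degreeIn A v
  AdjIn⇒0<degreeIn A {v} {u} vu = subst (_≤ degreeIn A v) (AdjIn⇒⟦⟧≡1 A vu) (≤-sum _ u)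

  0<degreeIn⇒AdjIn : ∀ A {v} → 0 < degreeIn A v → ∃ (AdjIn A v)
  0<degreeIn⇒AdjIn A {v} 0<d with 0<sum⇒∃0< _ 0<d
  ... | u , 0<⟦⟧ with A u ∧ adj G v u in eq
  ...   | true = u , proj₂ ∧-conical (A u) _ eq , proj₁ ∧-conical (A u) _ eq

  AdjIn⇒0<⟦⟧ : ∀ A {v u} → AdjIn A v u → 0 < ⟦ A u ∧ adj G v u ⟧
  AdjIn⇒0<⟦⟧ A vu = ≤-reflexive (sym (AdjIn⇒⟦⟧≡1 A vu))

  distinct-AdjIn⇒2≤degreeIn : ∀ A {v a b} → a ≢ b → AdjIn A v a → AdjIn A v b → 2 ≤ degreeIn A v
  distinct-AdjIn⇒2≤degreeIn A {v} {a} {b} a≢b va vb = injective-positive⇒≤sum _ e e-inj e-adj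
    where
    e : Fin 2 → Fin n
    e zero = a
    e (suc _) = b
    e-adj : ∀ j → 0 < ⟦ A (e j) ∧ adj G v (e j) ⟧
    e-adj zero = AdjIn⇒0<⟦⟧ A va
    e-adj (suc zero) = AdjIn⇒0<⟦⟧ A vb
    e-inj : Injective _≡_ _≡_ e
    e-inj {zero} {zero} _ = refl
    e-inj {zero} {suc zero} eq = contradiction eq a≢b
    e-inj {suc zero} {zero} eq = contradiction (sym eq) a≢b
    e-inj {suc zero} {suc zero} _ = refl

  distinct-Adj⇒3≤degree : ∀ {v a b c} → a ≢ b → a ≢ c → b ≢ c →
                          Adj G v a → Adj G v b → Adj G v c → 3 ≤ degree G v
  distinct-Adj⇒3≤degree {v} {a} {b} {c} a≢b a≢c b≢c va vb vc =
    subst (3 ≤_) (sym (degree≡degreeIn-all v)) (injective-positive⇒≤sum _ e e-inj e-adj)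
    where
    e : Fin 3 → Fin n
    e zero = a
    e (suc zero) = b
    e (suc (suc _)) = c
    e-adj : ∀ j → 0 < ⟦ adj G v (e j) ⟧
    e-adj zero = AdjIn⇒0<⟦⟧ _ (va , refl)
    e-adj (suc zero) = AdjIn⇒0<⟦⟧ _ (vb , refl)
    e-adj (suc (suc zero)) = AdjIn⇒0<⟦⟧ _ (vc , refl)
    e-inj : Injective _≡_ _≡_ e
    e-inj {zero} {zero} _ = refl
    e-inj {zero} {suc zero} eq = contradiction eq a≢b
    e-inj {zero} {suc (suc zero)} eq = contradiction eq a≢c
    e-inj {suc zero} {zero} eq = contradiction (sym eq) a≢b
    e-inj {suc zero} {suc zero} _ = refl
    e-inj {suc zero} {suc (suc zero)} eq = contradiction eq b≢c
    e-inj {suc (suc zero)} {zero} eq = contradiction (sym eq) a≢c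
    e-inj {suc (suc zero)} {suc zero} eq = contradiction (sym eq) b≢c
    e-inj {suc (suc zero)} {suc (suc zero)} _ = refl

  edges : (Fin n → Bool) → (Fin n → Bool) → ℕ
  edges X Y = ∑[ v < n ] ∑[ u < n ] ⟦ X v ∧ Y u ∧ adj G v u ⟧

  edges-comm : ∀ X Y → edges X Y ≡ edges Y X
  edges-comm X Y = trans (∑-comm (λ v u → ⟦ X v ∧ Y u ∧ adj G v u ⟧)) (sum-cong-≗ λ u → sum-cong-≗ λ v → flip (X v) (Y u) (adj-sym G v u))
    where
    flip : ∀ x y {a b} → a ≡ b → ⟦ x ∧ y ∧ a ⟧ ≡ ⟦ y ∧ x ∧ b ⟧
    flip true true refl = refl
    flip true false _ = refl
    flip false true _ = refl
    flip false false _ = refl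

  edges-mono : ∀ {X Y X′ Y′} → (∀ v u → Adj G v u → X v ≡ true → Y u ≡ true → X′ v ≡ true × Y′ u ≡ true) →
               edges X Y ≤ edges X′ Y′
  edges-mono {X} {Y} {X′} {Y′} ⊆′ = sum-mono-≤ λ v → sum-mono-≤ λ u → term v u
    where
    term : ∀ v u → ⟦ X v ∧ Y u ∧ adj G v u ⟧ ≤ ⟦ X′ v ∧ Y′ u ∧ adj G v u ⟧
    term v u with X v in Xv | Y u in Yu | adj G v u in vu
    ... | true | true | true rewrite proj₁ (⊆′ v u vu Xv Yu) | proj₂ (⊆′ v u vu Xv Yu) = ≤-refl
    ... | true | true | false = z≤n
    ... | true | false | _ = z≤n
    ... | false | _ | _ = z≤n

-- Walks in forests

module _ {n : ℕ} (G : Graph n) where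

  IsNBWalk : (ℕ → Fin n) → ℕ → Set
  IsNBWalk w m = (∀ i → suc i < m → Adj G (w i) (w (suc i))) ×
                 (∀ i → suc (suc i) < m → w (suc (suc i)) ≢ w i)

  closed-segment⇒IsCycle : ∀ {w m} → IsNBWalk w m → ∀ i L → 0 < L → i + L < m → w (i + L) ≡ w i →
                           (∀ s t → s < t → t < L → w (i + s) ≢ w (i + t)) →
                           IsCycle G L (λ t → w (i + toℕ t))
  closed-segment⇒IsCycle {w} {m} (adjacent , nonreturning) i L 0<L i+L<m closes distinct =
    3≤L , (injective , consecutive) , closing
    where
    step : ∀ s → suc s ≤ L → Adj G (w (i + s)) (w (i + suc s))
    step s s<L = subst (λ x → Adj G (w (i + s)) (w x)) (sym (+-suc i s))
                   (adjacent (i + s) (subst (_< m) (+-suc i s) (≤-<-trans (+-monoʳ-≤ i s<L) i+L<m)))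
    ends-at : ∀ x → L ≡ x → w (i + x) ≡ w i
    ends-at x refl = closes
    3≤L : 3 ≤ L
    3≤L = 3≤ L 0<L L≢1 L≢2
      where
      L≢1 : L ≢ 1
      L≢1 L≡1 = Adj⇒≢ G (step 0 (≤-reflexive (sym L≡1))) (trans (cong w (+-identityʳ i)) (sym (ends-at 1 L≡1)))
      L≢2 : L ≢ 2
      L≢2 L≡2 = nonreturning i (subst (_< m) (trans (cong (i +_) L≡2) (+-comm i 2)) i+L<m)
                  (trans (cong w (+-comm 2 i)) (ends-at 2 L≡2))
      3≤ : ∀ x → 0 < x → x ≢ 1 → x ≢ 2 → 3 ≤ x
      3≤ 1 _ x≢1 _ = contradiction refl x≢1
      3≤ 2 _ _ x≢2 = contradiction refl x≢2
      3≤ (suc (suc (suc _))) _ _ _ = s≤s (s≤s (s≤s z≤n))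
    injective : ∀ {s t : Fin L} → w (i + toℕ s) ≡ w (i + toℕ t) → s ≡ t
    injective {s} {t} eq with <-cmp (toℕ s) (toℕ t)
    ... | tri< s<t _ _ = contradiction eq (distinct _ _ s<t (toℕ<n t))
    ... | tri≈ _ s≡t _ = toℕ-injective s≡t
    ... | tri> _ _ t<s = contradiction (sym eq) (distinct _ _ t<s (toℕ<n s))
    consecutive : ∀ (s t : Fin L) → toℕ t ≡ suc (toℕ s) → Adj G (w (i + toℕ s)) (w (i + toℕ t))
    consecutive s t t≡1+s rewrite t≡1+s = step (toℕ s) (subst (_≤ L) t≡1+s (<⇒≤ (toℕ<n t)))
    closing : ∀ (s t : Fin L) → suc (toℕ s) ≡ L → toℕ t ≡ 0 → Adj G (w (i + toℕ s)) (w (i + toℕ t))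
    closing s t 1+s≡L t≡0 rewrite t≡0 | +-identityʳ i =
      subst (Adj G (w (i + toℕ s))) (trans (cong (λ x → w (i + x)) 1+s≡L) closes) (step (toℕ s) (≤-reflexive 1+s≡L))

  -- The first revisit of a non-backtracking walk would close a cycle.
  nbWalk-no-revisit : IsForest G → ∀ {w m} → IsNBWalk w m →
                      ∀ j → j < m → ∀ a b → a < b → b ≤ j → w a ≢ w b
  nbWalk-no-revisit forest walk zero _ a b a<b b≤0 = contradiction (≤-trans a<b b≤0) λ ()
  nbWalk-no-revisit forest {w} {m} walk (suc j) j<m a b a<b b≤j with m≤n⇒m<n∨m≡n b≤j
  ... | inj₁ b<1+j = nbWalk-no-revisit forest walk j (<-trans (n<1+n j) j<m) a b a<b (s≤s⁻¹ b<1+j)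
  ... | inj₂ refl = λ wa≡wb → forest (b ∸ a) _ (closed-segment⇒IsCycle walk a (b ∸ a) (m<n⇒0<n∸m a<b)
                                  (subst (_< m) (sym a+L≡b) j<m) (trans (cong w a+L≡b) (sym wa≡wb)) inner)
    where
    a+L≡b : a + (b ∸ a) ≡ b
    a+L≡b = m+[n∸m]≡n (<⇒≤ a<b)
    inner : ∀ s t → s < t → t < b ∸ a → w (a + s) ≢ w (a + t)
    inner s t s<t t<L = nbWalk-no-revisit forest walk j (<-trans (n<1+n j) j<m) (a + s) (a + t)
                          (+-monoʳ-< a s<t) (s≤s⁻¹ (subst (a + t <_) a+L≡b (+-monoʳ-< a t<L)))

  nbWalk-injective : IsForest G → ∀ {w m} → IsNBWalk w m →
                     ∀ {i j} → i < m → j < m → w i ≡ w j → i ≡ j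
  nbWalk-injective forest walk {i} {j} i<m j<m eq with <-cmp i j
  ... | tri< i<j _ _ = contradiction eq (nbWalk-no-revisit forest walk j j<m i j i<j ≤-refl)
  ... | tri≈ _ i≡j _ = i≡j
  ... | tri> _ _ j<i = contradiction (sym eq) (nbWalk-no-revisit forest walk i i<m j i j<i ≤-refl)

  private
    other-neighbour? : ∀ A p c → Dec (∃ λ u → AdjIn G A c u × u ≢ p)
    other-neighbour? A p c = any? λ u → ((adj G c u Bool.≟ true) ×-dec (A u Bool.≟ true)) ×-dec ¬? (u Fin.≟ p)

  -- Some neighbour of c in A other than p (p itself if there is none).
  turn : (Fin n → Bool) → Fin n → Fin n → Fin n
  turn A p c with other-neighbour? A p c
  ... | yes (u , _) = u
  ... | no _ = p

  turn-spec : ∀ A p c → 2 ≤ degreeIn G A c → AdjIn G A c (turn A p c) × turn A p c ≢ p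
  turn-spec A p c 2≤d with other-neighbour? A p c
  ... | yes (u , cu , u≢p) = cu , u≢p
  ... | no none = contradiction (subst (2 ≤_) (sum-single _ p only-p) 2≤d) (λ 2≤⟦⟧ → ⟦⟧≤1 _ 2≤⟦⟧)
    where
    only-p : ∀ u → u ≢ p → ⟦ A u ∧ adj G c u ⟧ ≡ 0
    only-p u u≢p with A u in Au | adj G c u in cu
    ... | true | true = contradiction (u , (cu , Au) , u≢p) none
    ... | true | false = refl
    ... | false | _ = refl
    ⟦⟧≤1 : ∀ b → ¬ 2 ≤ ⟦ b ⟧
    ⟦⟧≤1 true (s≤s ())
    ⟦⟧≤1 false ()

  walkPairs : (Fin n → Bool) → Fin n → Fin n → ℕ → Fin n × Fin n
  walkPairs A p c zero = p , c
  walkPairs A p c (suc j) = proj₂ (walkPairs A p c j) , turn A (proj₁ (walkPairs A p c j)) (proj₂ (walkPairs A p c j))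

  walk : (Fin n → Bool) → Fin n → Fin n → ℕ → Fin n
  walk A p c j = proj₁ (walkPairs A p c j)

  walk-turn : ∀ A p c j → 2 ≤ degreeIn G A (walk A p c (suc j)) →
              AdjIn G A (walk A p c (suc j)) (walk A p c (suc (suc j))) × walk A p c (suc (suc j)) ≢ walk A p c j
  walk-turn A p c j = turn-spec A (walk A p c j) (walk A p c (suc j))

  forest-leaf : IsForest G → ∀ A {u v} → A u ≡ true → AdjIn G A u v → ∃ λ x → A x ≡ true × degreeIn G A x ≡ 1
  forest-leaf forest A {u} {v} Au uv with any? (λ x → (A x Bool.≟ true) ×-dec (degreeIn G A x ≟ 1))
  ... | yes leaf = leaf
  ... | no no-leaf = contradiction (nbWalk-injective forest nbWalk (toℕ<n i) (toℕ<n j) wi≡wj) (<⇒≢ i<j)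
    where
    w : ℕ → Fin n
    w = walk A u v
    not-leaf : ∀ {x y} → A x ≡ true → AdjIn G A x y → 2 ≤ degreeIn G A x
    not-leaf {x} Ax xy with degreeIn G A x in d | AdjIn⇒0<degreeIn G A xy
    ... | 1 | _ = contradiction (x , Ax , d) no-leaf
    ... | suc (suc _) | _ = s≤s (s≤s z≤n)
    steps : ∀ j → A (w j) ≡ true × AdjIn G A (w j) (w (suc j))
    steps zero = Au , uv
    steps (suc j) with steps j
    ... | Awj , wj→ = proj₂ wj→ , proj₁ (walk-turn A u v j (not-leaf (proj₂ wj→) (Adj-sym G (proj₁ wj→) , Awj)))
    nbWalk : IsNBWalk w (suc n)
    nbWalk = (λ j _ → proj₁ (proj₂ (steps j))) ,
             (λ j _ → let Awj , wj→ = steps j in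
                      proj₂ (walk-turn A u v j (not-leaf (proj₂ wj→) (Adj-sym G (proj₁ wj→) , Awj))))
    repeat = pigeonhole (n<1+n n) (λ t → w (toℕ t))
    i = proj₁ repeat
    j = proj₁ (proj₂ repeat)
    i<j = proj₁ (proj₂ (proj₂ repeat))
    wi≡wj = proj₂ (proj₂ (proj₂ repeat))

-- Forests have fewer edges than vertices

-- With isolated vertices weighted 2, the total weight is twice the number of edges plus twice the number of isolated vertices.
weight : ℕ → ℕ
weight zero = 2
weight (suc d) = suc d

module _ {n : ℕ} where

  card : (Fin n → Bool) → ℕ
  card A = ∑[ v < n ] ⟦ A v ⟧

  _∖_ : (Fin n → Bool) → Fin n → Fin n → Bool
  (A ∖ x) v = A v ∧ not (does (v Fin.≟ x))

  ∖-≢ : ∀ A {x v} → v ≢ x → (A ∖ x) v ≡ A v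
  ∖-≢ A {x} {v} v≢x rewrite dec-false (v Fin.≟ x) v≢x = ∧-identityʳ (A v)

  ∖-self : ∀ A x → (A ∖ x) x ≡ false
  ∖-self A x rewrite dec-true (x Fin.≟ x) refl = ∧-zeroʳ (A x)

  card-∖ : ∀ A {x} → A x ≡ true → card A ≡ suc (card (A ∖ x))
  card-∖ A {x} Ax = begin
    card A                         ≡⟨ sym (+-identityʳ (card A)) ⟩
    card A + 0                     ≡⟨ cong (λ b → card A + ⟦ b ⟧) (sym (∖-self A x)) ⟩
    card A + ⟦ (A ∖ x) x ⟧         ≡⟨ sum-update x (λ v v≢x → cong ⟦_⟧ (sym (∖-≢ A v≢x))) ⟩
    card (A ∖ x) + ⟦ A x ⟧         ≡⟨ cong (λ b → card (A ∖ x) + ⟦ b ⟧) Ax ⟩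
    card (A ∖ x) + 1               ≡⟨ +-comm (card (A ∖ x)) 1 ⟩
    suc (card (A ∖ x))             ∎
    where open ≡-Reasoning

module _ {n : ℕ} (G : Graph n) where

  weightIn : (Fin n → Bool) → ℕ
  weightIn A = ∑[ v < n ] (⟦ A v ⟧ * weight (degreeIn G A v))

  module LeafRemoval (A : Fin n → Bool) {x y : Fin n} (Ax : A x ≡ true) (leaf : degreeIn G A x ≡ 1)
                     (xy : AdjIn G A x y) where

    x≢y : x ≢ y
    x≢y = Adj⇒≢ G (proj₁ xy)

    only-neighbour : ∀ {v} → AdjIn G A x v → v ≡ y
    only-neighbour {v} xv with v Fin.≟ y
    ... | yes v≡y = v≡y
    ... | no v≢y = contradiction (subst (2 ≤_) leaf (distinct-AdjIn⇒2≤degreeIn G A v≢y xv xy)) λ { (s≤s ()) }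

    degreeIn-∖-≢ : ∀ v → v ≢ y → A v ≡ true → degreeIn G (A ∖ x) v ≡ degreeIn G A v
    degreeIn-∖-≢ v v≢y Av = sum-cong-≗ term
      where
      term : ∀ u → ⟦ (A ∖ x) u ∧ adj G v u ⟧ ≡ ⟦ A u ∧ adj G v u ⟧
      term u with u Fin.≟ x
      ... | no _ = cong (λ b → ⟦ b ∧ adj G v u ⟧) (∧-identityʳ (A u))
      ... | yes refl with adj G v x in vx
      ...   | true = contradiction (only-neighbour (Adj-sym G vx , Av)) v≢y
      ...   | false = cong ⟦_⟧ (trans (∧-zeroʳ _) (sym (∧-zeroʳ _)))

    degreeIn-∖-y : degreeIn G A y ≡ suc (degreeIn G (A ∖ x) y)
    degreeIn-∖-y = begin
      degreeIn G A y                                 ≡⟨ sym (trans (cong (λ b → degreeIn G A y + ⟦ b ∧ adj G y x ⟧) (∖-self A x)) (+-identityʳ _)) ⟩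
      degreeIn G A y + ⟦ (A ∖ x) x ∧ adj G y x ⟧     ≡⟨ sum-update x (λ u u≢x → cong (λ b → ⟦ b ∧ adj G y u ⟧) (sym (∖-≢ A u≢x))) ⟩
      degreeIn G (A ∖ x) y + ⟦ A x ∧ adj G y x ⟧     ≡⟨ cong (degreeIn G (A ∖ x) y +_) (AdjIn⇒⟦⟧≡1 G A (Adj-sym G (proj₁ xy) , Ax)) ⟩
      degreeIn G (A ∖ x) y + 1                       ≡⟨ +-comm _ 1 ⟩
      suc (degreeIn G (A ∖ x) y)                     ∎
      where open ≡-Reasoning

    -- Only the terms of x and y change.
    weightIn-∖ : weightIn A + weight (degreeIn G (A ∖ x) y) ≡
                 weightIn (A ∖ x) + suc (weight (suc (degreeIn G (A ∖ x) y)))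
    weightIn-∖ = begin
      weightIn A + weight d′                                      ≡⟨ cong (weightIn A +_) (sym (*-identityˡ _)) ⟩
      weightIn A + (⟦ false ⟧ * weight dₓ + ⟦ true ⟧ * weight d′) ≡⟨ cong₂ (λ a b → weightIn A + (⟦ a ⟧ * weight dₓ + ⟦ b ⟧ * weight d′))
                                                                       (sym (∖-self A x)) (sym (trans (∖-≢ A (x≢y ∘ sym)) Ay)) ⟩
      weightIn A + (term (A ∖ x) x + term (A ∖ x) y)              ≡⟨ sum-update₂ x≢y unchanged ⟩
      weightIn (A ∖ x) + (term A x + term A y)                    ≡⟨ cong₂ (λ a b → weightIn (A ∖ x) + (a + b))
                                                                       (cong₂ (λ a d → ⟦ a ⟧ * weight d) Ax leaf)
                                                                       (cong₂ (λ a d → ⟦ a ⟧ * weight d) Ay degreeIn-∖-y) ⟩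
      weightIn (A ∖ x) + (1 + 1 * weight (suc d′))                ≡⟨ cong (λ z → weightIn (A ∖ x) + suc z) (*-identityˡ _) ⟩
      weightIn (A ∖ x) + suc (weight (suc d′))                    ∎
      where
      open ≡-Reasoning
      d′ = degreeIn G (A ∖ x) y
      dₓ = degreeIn G (A ∖ x) x
      Ay = proj₂ xy
      term : (Fin n → Bool) → Fin n → ℕ
      term B v = ⟦ B v ⟧ * weight (degreeIn G B v)
      unchanged : ∀ v → v ≢ x → v ≢ y → term A v ≡ term (A ∖ x) v
      unchanged v v≢x v≢y with A v in Av
      ... | false = refl
      ... | true rewrite dec-false (v Fin.≟ x) v≢x = cong (λ d → 1 * weight d) (sym (degreeIn-∖-≢ v v≢y Av))

  weightIn≤2card : IsForest G → ∀ c A → card A ≡ c → weightIn A ≤ 2 * card A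
  weightIn+2≤2card : IsForest G → ∀ c A → card A ≡ c → ∀ {u v} → A u ≡ true → AdjIn G A u v →
                     weightIn A + 2 ≤ 2 * card A

  weightIn≤2card forest c A c≡ with any? (λ v → (A v Bool.≟ true) ×-dec (0 <? degreeIn G A v))
  ... | yes (u , Au , 0<d) = ≤-trans (m≤m+n _ 2) (weightIn+2≤2card forest c A c≡ Au (proj₂ (0<degreeIn⇒AdjIn G A 0<d)))
  ... | no no-edge = ≤-reflexive (trans (sum-cong-≗ isolated) (sym (*-distribˡ-sum 2 (λ v → ⟦ A v ⟧))))
    where
    isolated : ∀ v → ⟦ A v ⟧ * weight (degreeIn G A v) ≡ 2 * ⟦ A v ⟧
    isolated v with A v in Av | degreeIn G A v in d
    ... | false | _ = refl
    ... | true | zero = refl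
    ... | true | suc _ = contradiction (v , Av , subst (0 <_) (sym d) (s≤s z≤n)) no-edge

  weightIn+2≤2card forest zero A c≡0 {u} Au _ =
    contradiction (subst (_≤ card A) (cong ⟦_⟧ Au) (≤-sum _ u)) (λ 1≤card → 1+n≰n (≤-trans 1≤card (≤-reflexive c≡0)))
  weightIn+2≤2card forest (suc c) A c≡ Au uv = removing-leaf (degreeIn G (A ∖ x) y) refl
    where
    leaf = forest-leaf G forest A Au uv
    x = proj₁ leaf
    xy = 0<degreeIn⇒AdjIn G A (≤-reflexive (sym (proj₂ (proj₂ leaf))))
    y = proj₁ xy
    open LeafRemoval A (proj₁ (proj₂ leaf)) (proj₂ (proj₂ leaf)) (proj₂ xy)
    card′ : card (A ∖ x) ≡ c
    card′ = suc-injective (trans (sym (card-∖ A (proj₁ (proj₂ leaf)))) c≡)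
    2card : 2 * card A ≡ 2 + 2 * card (A ∖ x)
    2card = trans (cong (2 *_) (card-∖ A (proj₁ (proj₂ leaf)))) (*-suc 2 _)
    A′y : (A ∖ x) y ≡ true
    A′y = trans (∖-≢ A (x≢y ∘ sym)) (proj₂ (proj₂ xy))
    -- If y becomes isolated its weight rises from 1 to 2, so the weight is unchanged;
    -- otherwise it drops by 2 and A ∖ x still has an edge.
    removing-leaf : ∀ d → degreeIn G (A ∖ x) y ≡ d → weightIn A + 2 ≤ 2 * card A
    removing-leaf zero d≡0 = begin
      weightIn A + 2       ≡⟨ subst (λ d → weightIn A + weight d ≡ weightIn (A ∖ x) + suc (weight (suc d))) d≡0 weightIn-∖ ⟩
      weightIn (A ∖ x) + 2 ≤⟨ +-monoˡ-≤ 2 (weightIn≤2card forest c (A ∖ x) card′) ⟩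
      2 * card (A ∖ x) + 2 ≡⟨ trans (+-comm _ 2) (sym 2card) ⟩
      2 * card A           ∎
      where open ≤-Reasoning
    removing-leaf (suc d) d≡1+d = begin
      weightIn A + 2           ≡⟨ cong (_+ 2) weightIn≡ ⟩
      weightIn (A ∖ x) + 2 + 2 ≤⟨ +-monoˡ-≤ 2 (weightIn+2≤2card forest c (A ∖ x) card′ A′y (proj₂ (0<degreeIn⇒AdjIn G (A ∖ x) (subst (0 <_) (sym d≡1+d) (s≤s z≤n))))) ⟩
      2 * card (A ∖ x) + 2     ≡⟨ trans (+-comm _ 2) (sym 2card) ⟩
      2 * card A               ∎
      where
      open ≤-Reasoning
      weightIn≡ : weightIn A ≡ weightIn (A ∖ x) + 2
      weightIn≡ = +-cancelʳ-≡ (suc d) _ _ (trans (subst (λ d′ → weightIn A + weight d′ ≡ weightIn (A ∖ x) + suc (weight (suc d′))) d≡1+d weightIn-∖)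
                                           (sym (+-assoc (weightIn (A ∖ x)) 2 (suc d))))

-- Two walks leaving the edge U 0 – U 1 in opposite directions, the first reversed and followed by the second.
reverse-append : ∀ {n} (U V : ℕ → Fin n) → ℕ → ℕ → Fin n
reverse-append U V a t with t ≤? a
... | yes _ = U (suc a ∸ t)
... | no _ = V (t ∸ a)

module _ {n : ℕ} (G : Graph n) where

  module _ {U V : ℕ → Fin n} {a b : ℕ} (U-walk : IsNBWalk G U (2 + a)) (V-walk : IsNBWalk G V (2 + b))
           (U₀≡V₁ : U 0 ≡ V 1) (U₁≡V₀ : U 1 ≡ V 0) where

    private
      W = reverse-append U V a

      W-U : ∀ t → t ≤ suc a → W t ≡ U (suc a ∸ t)
      W-U t t≤1+a with t ≤? a | m≤n⇒m<n∨m≡n t≤1+a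
      ... | yes _ | _ = refl
      ... | no t≰a | inj₁ t<1+a = contradiction (s≤s⁻¹ t<1+a) t≰a
      ... | no _ | inj₂ refl = trans (cong V (m+n∸n≡m 1 a)) (trans (sym U₀≡V₁) (cong U (sym (n∸n≡0 (suc a)))))

      W-V : ∀ t → a ≤ t → W t ≡ V (t ∸ a)
      W-V t a≤t with t ≤? a
      ... | no _ = refl
      ... | yes t≤a rewrite ≤-antisym t≤a a≤t = trans (cong U (m+n∸n≡m 1 a)) (trans U₁≡V₀ (cong V (sym (n∸n≡0 a))))

    reverse-append-IsNBWalk : IsNBWalk G (reverse-append U V a) (2 + a + b)
    reverse-append-IsNBWalk = adjacent , nonreturning
      where
      adjacent : ∀ i → suc i < 2 + a + b → Adj G (W i) (W (suc i))
      adjacent i i+1<m with i <? suc a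
      ... | yes i<1+a = subst₂ (Adj G)
          (sym (trans (W-U i (<⇒≤ i<1+a)) (cong U (+-∸-assoc 1 (s≤s⁻¹ i<1+a)))))
          (sym (W-U (suc i) i<1+a))
          (Adj-sym G (proj₁ U-walk (a ∸ i) (s≤s (s≤s (m∸n≤m a i)))))
      ... | no i≮1+a = subst₂ (Adj G)
          (sym (W-V i a≤i))
          (sym (trans (W-V (suc i) (m≤n⇒m≤1+n a≤i)) (cong V (+-∸-assoc 1 a≤i))))
          (proj₁ V-walk (i ∸ a) (s≤s (s≤s (m≤n+o⇒m∸n≤o i a (s≤s⁻¹ (s≤s⁻¹ i+1<m))))))
        where
        a≤i = <⇒≤ (≮⇒≥ i≮1+a)
      nonreturning : ∀ i → suc (suc i) < 2 + a + b → W (suc (suc i)) ≢ W i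
      nonreturning i i+2<m with i <? a
      ... | yes i<a = λ eq → proj₂ U-walk (a ∸ suc i) (s≤s (s≤s (subst (_≤ a) (+-∸-assoc 1 i<a) (m∸n≤m a i))))
          (begin
            U (suc (suc (a ∸ suc i))) ≡⟨ cong U (sym (trans (+-∸-assoc 1 (<⇒≤ i<a)) (cong suc (+-∸-assoc 1 i<a)))) ⟩
            U (suc a ∸ i)             ≡⟨ sym (W-U i (m≤n⇒m≤1+n (<⇒≤ i<a))) ⟩
            W i                       ≡⟨ sym eq ⟩
            W (suc (suc i))           ≡⟨ W-U (suc (suc i)) (s≤s i<a) ⟩
            U (a ∸ suc i)             ∎)
        where open ≡-Reasoning
      ... | no i≮a = λ eq → proj₂ V-walk (i ∸ a) (s≤s (s≤s (subst (_≤ b) (+-∸-assoc 1 a≤i)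
                                    (m≤n+o⇒m∸n≤o (suc i) a (s≤s⁻¹ (s≤s⁻¹ i+2<m))))))
          (begin
            V (suc (suc (i ∸ a))) ≡⟨ cong V (sym (+-∸-assoc 2 a≤i)) ⟩
            V (suc (suc i) ∸ a)   ≡⟨ sym (W-V (suc (suc i)) (≤-trans a≤i (≤-trans (n≤1+n i) (n≤1+n (suc i))))) ⟩
            W (suc (suc i))       ≡⟨ eq ⟩
            W i                   ≡⟨ W-V i a≤i ⟩
            V (i ∸ a)             ∎)
        where
        open ≡-Reasoning
        a≤i = ≮⇒≥ i≮a

-- The lower bound

even-or-odd : ∀ m → ∃ λ h → m ≡ h + h ⊎ m ≡ suc (h + h)
even-or-odd zero = 0 , inj₁ refl
even-or-odd (suc m) with even-or-odd m
... | h , inj₁ m≡2h = h , inj₂ (cong suc m≡2h)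
... | h , inj₂ m≡2h+1 = suc h , inj₁ (cong suc (trans m≡2h+1 (sym (+-suc h h))))

≤-by : ∀ {x y} s → y ≡ x + s → x ≤ y
≤-by {x} s y≡x+s = subst (x ≤_) (sym y≡x+s) (m≤m+n x s)

-- The cases of the per-vertex inequality, for k = 1 + k₁ (so 3k - 1 = 2 + 3k₁):
-- an isolated vertex of P, another vertex of P, a branching vertex outside P and a free vertex.
isolated-in-P : ∀ k₁ → 2 + 2 * (2 + 3 * k₁) + k₁ * (1 * 0) ≤ 4 * suc k₁ * 1 + (2 + 3 * k₁) * 2 + 2 * 0
isolated-in-P k₁ = ≤-by (2 + 4 * k₁) (solve (k₁ ∷ []))

vertex-in-P : ∀ k₁ d → 2 + 2 * (2 + 3 * k₁) + k₁ * (1 * (1 + d)) ≤ 4 * suc k₁ * 1 + (2 + 3 * k₁) * (1 + d) + 2 * 0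
vertex-in-P k₁ d = ≤-by (2 * d + 2 * k₁ * d) (solve (k₁ ∷ d ∷ []))

vertex-branching : ∀ k₁ d → 2 + 2 * (2 + 3 * k₁) + k₁ * (1 * (3 + d)) ≤ 4 * suc k₁ * 0 + (2 + 3 * k₁) * (3 + d) + 2 * 0
vertex-branching k₁ d = ≤-by (2 * d + 2 * k₁ * d) (solve (k₁ ∷ d ∷ []))

vertex-free : ∀ k₁ → 2 + 2 * (2 + 3 * k₁) + k₁ * (0 * 2) ≤ 4 * suc k₁ * 0 + (2 + 3 * k₁) * 2 + 2 * 1
vertex-free k₁ = ≤-by 0 (solve (k₁ ∷ []))

n+3k∸1≡ : ∀ n k₁ → n + 3 * suc k₁ ∸ 1 ≡ n + (2 + 3 * k₁)
n+3k∸1≡ n k₁ = cong (_∸ 1) (rearrange n k₁)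
  where
  rearrange : ∀ n k₁ → n + 3 * suc k₁ ≡ suc (n + (2 + 3 * k₁))
  rearrange = solve-∀

module _ {n : ℕ} (G : Graph n) (forest : IsForest G) (k : ℕ) (P : Subset n)
         (cover : IsBranchingPathCover G k P) where

  blocking : Fin n → Bool
  blocking v = lookup P v ∨ does (3 ≤? degree G v)

  free : Fin n → Bool
  free v = not (blocking v)

  private
    free-parts : ∀ {v} → free v ≡ true → lookup P v ≡ false × does (3 ≤? degree G v) ≡ false
    free-parts fv = proj₁ ∨-conical _ _ (not-injective fv) , proj₂ ∨-conical _ _ (not-injective fv)

  free⇒unblocked : ∀ {v} → free v ≡ true → ¬ (Branching G v ⊎ v ∈ P)
  free⇒unblocked fv (inj₁ 3≤d) = contradiction (trans (sym (dec-true (3 ≤? _) 3≤d)) (proj₂ (free-parts fv))) λ ()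
  free⇒unblocked fv (inj₂ v∈P) = contradiction (trans (sym ([]=⇒lookup v∈P)) (proj₁ (free-parts fv))) λ ()

  free⇒degree≡2 : ∀ {v} → free v ≡ true → degree G v ≡ 2
  free⇒degree≡2 {v} fv = ≤-antisym (s≤s⁻¹ (≰⇒> (free⇒unblocked fv ∘ inj₁)))
                                    (≰⇒> (free⇒unblocked fv ∘ inj₂ ∘ proj₁ cover v))

  free⇒2≤degreeIn : ∀ {v} → free v ≡ true → 2 ≤ degreeIn G (λ _ → true) v
  free⇒2≤degreeIn {v} fv = ≤-reflexive (sym (trans (sym (degree≡degreeIn-all G v)) (free⇒degree≡2 fv)))

  -- reach t: the blocking vertices and the free vertices joined to one through at most t free vertices.
  reach : ℕ → Fin n → Bool
  reach zero = blocking
  reach (suc t) v = reach t v ∨ (free v ∧ does (0 <? degreeIn G (reach t) v))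

  reach-suc : ∀ t {v} → reach t v ≡ true → reach (suc t) v ≡ true
  reach-suc t rv rewrite rv = refl

  unreached⇒free : ∀ t {v} → reach t v ≡ false → free v ≡ true
  unreached⇒free t {v} rv with blocking v in bv
  ... | false = refl
  ... | true = contradiction (trans (sym (blocking⇒reach t bv)) rv) λ ()
    where
    blocking⇒reach : ∀ t → blocking v ≡ true → reach t v ≡ true
    blocking⇒reach zero bv = bv
    blocking⇒reach (suc t) bv = reach-suc t (blocking⇒reach t bv)

  reach-grow : ∀ t {v u} → free v ≡ true → Adj G v u → reach t u ≡ true → reach (suc t) v ≡ true
  reach-grow t {v} fv vu ru
    rewrite fv | dec-true (0 <? degreeIn G (reach t) v) (AdjIn⇒0<degreeIn G (reach t) (vu , ru)) = ∨-zeroʳ (reach t v)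

  newly-reached : ∀ t {v} → reach (suc t) v ≡ true → reach t v ≡ false → ∃ (AdjIn G (reach t) v)
  newly-reached t {v} r′v rv rewrite rv = 0<degreeIn⇒AdjIn G (reach t) (does⇒ (0 <? _) (proj₂ ∧-conical _ _ r′v))

  module _ {p c : Fin n} (r : ℕ) (pc : Adj G p c) (rc : reach r c ≡ false) where

    private
      w = walk G (λ _ → true) p c

    -- Walking away from p, the walk stays unreached (with decreasing bound), hence free.
    escape : ∀ j → j ≤ r → Adj G (w j) (w (suc j)) × reach (r ∸ j) (w (suc j)) ≡ false
    escape zero _ = pc , rc
    escape (suc j) j<r with escape j (<⇒≤ j<r)
    ... | _ , rwj = proj₁ (proj₁ next) , unreached
      where
      r∸j≡ : r ∸ j ≡ suc (r ∸ suc j)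
      r∸j≡ = +-∸-assoc 1 j<r
      next = walk-turn G _ p c j (free⇒2≤degreeIn (unreached⇒free (r ∸ j) rwj))
      unreached : reach (r ∸ suc j) (w (suc (suc j))) ≡ false
      unreached with reach (r ∸ suc j) (w (suc (suc j))) in rw
      ... | false = refl
      ... | true = contradiction (trans (sym (reach-grow (r ∸ suc j) (unreached⇒free (r ∸ j) rwj) (proj₁ (proj₁ next)) rw))
                                        (subst (λ t → reach t (w (suc j)) ≡ false) r∸j≡ rwj)) λ ()

    escape-free : ∀ j → j ≤ r → free (w (suc j)) ≡ true
    escape-free j j≤r = unreached⇒free (r ∸ j) (proj₂ (escape j j≤r))

    escape-IsNBWalk : IsNBWalk G w (2 + r)
    escape-IsNBWalk = (λ j j<r+2 → proj₁ (escape j (s≤s⁻¹ (s≤s⁻¹ j<r+2)))) ,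
                      (λ j j<r → proj₂ (walk-turn G _ p c j
                                   (free⇒2≤degreeIn (escape-free j (<⇒≤ (s≤s⁻¹ (s≤s⁻¹ j<r)))))))

  -- Otherwise the two escape walks from the edge u – v would glue into a k-path of free vertices.
  unreached-edge⇒2+r+s<k : ∀ {u v} r s → Adj G u v → reach r u ≡ false → reach s v ≡ false → 2 + r + s < k
  unreached-edge⇒2+r+s<k {u} {v} r s uv ru rv = ≰⇒> unblocked
    where
    U = walk G (λ _ → true) v u
    V = walk G (λ _ → true) u v
    W = reverse-append U V r
    W-walk : IsNBWalk G W (2 + r + s)
    W-walk = reverse-append-IsNBWalk G (escape-IsNBWalk r (Adj-sym G uv) ru) (escape-IsNBWalk s uv rv) refl refl
    W-free : ∀ t → t < 2 + r + s → free (W t) ≡ true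
    W-free t t<m with t ≤? r
    ... | yes t≤r = subst (λ x → free (U x) ≡ true) (sym (+-∸-assoc 1 t≤r)) (escape-free r (Adj-sym G uv) ru (r ∸ t) (m∸n≤m r t))
    ... | no t≰r = subst (λ x → free (V x) ≡ true) (sym (+-∸-assoc 1 (≰⇒> t≰r)))
                     (escape-free s uv rv (t ∸ suc r) (m≤n+o⇒m∸n≤o t (suc r) (s≤s⁻¹ t<m)))
    path : k ≤ 2 + r + s → IsPath G k (λ i → W (toℕ i))
    path k≤m = injective , consecutive
      where
      in-range : (i : Fin k) → toℕ i < 2 + r + s
      in-range i = ≤-trans (toℕ<n i) k≤m
      injective : ∀ {i j} → W (toℕ i) ≡ W (toℕ j) → i ≡ j
      injective {i} {j} eq = toℕ-injective (nbWalk-injective G forest W-walk (in-range i) (in-range j) eq)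
      consecutive : ∀ i j → toℕ j ≡ suc (toℕ i) → Adj G (W (toℕ i)) (W (toℕ j))
      consecutive i j j≡1+i rewrite j≡1+i = proj₁ W-walk (toℕ i) (subst (_< 2 + r + s) j≡1+i (in-range j))
    unblocked : ¬ (k ≤ 2 + r + s)
    unblocked k≤m with proj₂ cover _ (path k≤m)
    ... | i , blocked = free⇒unblocked (W-free (toℕ i) (≤-trans (toℕ<n i) k≤m)) blocked

  layer : ℕ → Fin n → Bool
  layer t v = reach (suc t) v ∧ not (reach t v)

  layer-spec : ∀ t {v} → layer t v ≡ true → reach (suc t) v ≡ true × reach t v ≡ false
  layer-spec t l = proj₁ ∧-conical _ _ l , not-injective (proj₂ ∧-conical _ _ l)

  layer⇒free : ∀ t {v} → layer t v ≡ true → free v ≡ true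
  layer⇒free t l = unreached⇒free t (proj₂ (layer-spec t l))

  -- Every vertex of layer t has a neighbour in reach t.
  card-layer≤edges : ∀ t → card (layer t) ≤ edges G (layer t) (reach t)
  card-layer≤edges t = sum-mono-≤ term
    where
    term : ∀ v → ⟦ layer t v ⟧ ≤ ∑[ u < n ] ⟦ layer t v ∧ reach t u ∧ adj G v u ⟧
    term v with layer t v in l
    ... | false = z≤n
    ... | true = let r′v , rv = layer-spec t l in
                 AdjIn⇒0<degreeIn G (reach t) (proj₂ (newly-reached t r′v rv))

  -- A vertex of layer t has degree 2 and a neighbour in reach t, so at most one neighbour in layer (t + 1).
  edges-next-layer≤card : ∀ t → edges G (layer (suc t)) (reach (suc t)) ≤ card (layer t)
  edges-next-layer≤card t = begin
    edges G (layer (suc t)) (reach (suc t)) ≤⟨ edges-mono G backwards ⟩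
    edges G (layer (suc t)) (layer t)       ≡⟨ edges-comm G (layer (suc t)) (layer t) ⟩
    edges G (layer t) (layer (suc t))       ≤⟨ sum-mono-≤ term ⟩
    card (layer t)                          ∎
    where
    open ≤-Reasoning
    backwards : ∀ v u → Adj G v u → layer (suc t) v ≡ true → reach (suc t) u ≡ true →
                layer (suc t) v ≡ true × layer t u ≡ true
    backwards v u vu l r′u with reach t u in ru
    ... | false rewrite r′u = l , refl
    ... | true = contradiction (trans (sym (reach-grow t (layer⇒free (suc t) l) vu ru)) (proj₂ (layer-spec (suc t) l))) λ ()
    term : ∀ v → ∑[ u < n ] ⟦ layer t v ∧ layer (suc t) u ∧ adj G v u ⟧ ≤ ⟦ layer t v ⟧
    term v with layer t v in l
    ... | false = ≤-reflexive (trans (sum-const n 0) (*-zeroʳ n))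
    ... | true = let r′v , rv = layer-spec t l
                     x , vx , rx = newly-reached t r′v rv in
      +-cancelʳ-≤ 1 _ 1 (begin
        degreeIn G (layer (suc t)) v + 1 ≤⟨ sum-mono-≤-at x (λ u → ⟦x∧y⟧≤⟦y⟧ (layer (suc t) u) _) (≤-reflexive (x-term rx vx)) ⟩
        degreeIn G (λ _ → true) v        ≡⟨ trans (sym (degree≡degreeIn-all G v)) (free⇒degree≡2 (layer⇒free t l)) ⟩
        2                                ∎)
      where
      x-term : ∀ {x} → reach t x ≡ true → Adj G v x → ⟦ layer (suc t) x ∧ adj G v x ⟧ + 1 ≡ ⟦ adj G v x ⟧
      x-term rx vx rewrite reach-suc t rx | vx = refl

  edges-layer≤edges-free-blocking : ∀ t → edges G (layer t) (reach t) ≤ edges G free blocking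
  edges-layer≤edges-free-blocking zero = edges-mono G λ v u _ l ru → layer⇒free 0 l , ru
  edges-layer≤edges-free-blocking (suc t) = begin
    edges G (layer (suc t)) (reach (suc t)) ≤⟨ edges-next-layer≤card t ⟩
    card (layer t)                          ≤⟨ card-layer≤edges t ⟩
    edges G (layer t) (reach t)             ≤⟨ edges-layer≤edges-free-blocking t ⟩
    edges G free blocking                   ∎
    where open ≤-Reasoning

  card-layer≤edges-free-blocking : ∀ t → card (layer t) ≤ edges G free blocking
  card-layer≤edges-free-blocking t = ≤-trans (card-layer≤edges t) (edges-layer≤edges-free-blocking t)

  card-free-reach-suc : ∀ t → card (λ v → free v ∧ reach (suc t) v) ≡ card (λ v → free v ∧ reach t v) + card (layer t)
  card-free-reach-suc t = trans (sum-cong-≗ (λ v → split (free v) (reach t v) _))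
                                (∑-distrib-+ (λ v → ⟦ free v ∧ reach t v ⟧) (λ v → ⟦ layer t v ⟧))
    where
    split : ∀ f r q → ⟦ f ∧ (r ∨ (f ∧ q)) ⟧ ≡ ⟦ f ∧ r ⟧ + ⟦ (r ∨ (f ∧ q)) ∧ not r ⟧
    split true true q = refl
    split true false true = refl
    split true false false = refl
    split false true q = refl
    split false false q = refl

  card-free-reach≤ : ∀ t → card (λ v → free v ∧ reach t v) ≤ t * edges G free blocking
  card-free-reach≤ zero = ≤-reflexive (trans (sum-cong-≗ λ v → cong ⟦_⟧ (not-∧-self (blocking v))) (trans (sum-const n 0) (*-zeroʳ n)))
    where
    not-∧-self : ∀ b → not b ∧ b ≡ false
    not-∧-self true = refl
    not-∧-self false = refl
  card-free-reach≤ (suc t) = begin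
    card (λ v → free v ∧ reach (suc t) v)             ≡⟨ card-free-reach-suc t ⟩
    card (λ v → free v ∧ reach t v) + card (layer t)   ≤⟨ +-mono-≤ (card-free-reach≤ t) (card-layer≤edges-free-blocking t) ⟩
    t * edges G free blocking + edges G free blocking  ≡⟨ +-comm (t * _) _ ⟩
    suc t * edges G free blocking                      ∎
    where open ≤-Reasoning

  free⇒reached : 2 ≤ k → ∀ h → k ≤ suc (h + h) → ∀ {v} → free v ≡ true → reach h v ≡ true
  free⇒reached 2≤k zero k≤1 _ = contradiction (≤-trans 2≤k k≤1) λ { (s≤s ()) }
  free⇒reached 2≤k (suc h) k≤ {v} fv with reach (suc h) v in r′v
  ... | true = refl
  ... | false = contradiction (subst (k ≤_) (cong (λ x → suc (suc x)) (+-suc h h)) k≤) (<⇒≱ (unreached-edge⇒2+r+s<k (suc h) h vb r′v rb))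
    where
    vb = proj₁ (proj₂ (0<degreeIn⇒AdjIn G _ (≤-trans (s≤s z≤n) (free⇒2≤degreeIn fv))))
    b = proj₁ (0<degreeIn⇒AdjIn G _ (≤-trans (s≤s z≤n) (free⇒2≤degreeIn fv)))
    rb : reach h b ≡ false
    rb with reach h b in rb
    ... | false = refl
    ... | true = contradiction (trans (sym (reach-grow h fv vb rb)) r′v) λ ()

  -- When k ≤ 2h + 2 both neighbours of a vertex in layer h lie in reach h.
  2card-top-layer≤edges : ∀ h → k ≤ 2 + (h + h) → 2 * card (layer h) ≤ edges G (layer h) (reach h)
  2card-top-layer≤edges h k≤ = subst (_≤ edges G (layer h) (reach h)) (sym (*-distribˡ-sum 2 (λ v → ⟦ layer h v ⟧)))
                                 (sum-mono-≤ term)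
    where
    term : ∀ v → 2 * ⟦ layer h v ⟧ ≤ ∑[ u < n ] ⟦ layer h v ∧ reach h u ∧ adj G v u ⟧
    term v with layer h v in l
    ... | false = z≤n
    ... | true = ≤-reflexive (sym (begin
      degreeIn G (reach h) v        ≡⟨ sum-cong-≗ neighbours-reached ⟩
      degreeIn G (λ _ → true) v     ≡⟨ sym (degree≡degreeIn-all G v) ⟩
      degree G v                    ≡⟨ free⇒degree≡2 (layer⇒free h l) ⟩
      2                             ∎))
      where
      open ≡-Reasoning
      neighbours-reached : ∀ u → ⟦ reach h u ∧ adj G v u ⟧ ≡ ⟦ adj G v u ⟧
      neighbours-reached u with adj G v u in vu | reach h u in ru
      ... | false | r = cong ⟦_⟧ (∧-zeroʳ r)
      ... | true | true = refl
      ... | true | false = contradiction k≤ (<⇒≱ (unreached-edge⇒2+r+s<k h h vu (proj₂ (layer-spec h l)) ru))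

  card-free≡card-free-reach : ∀ t → (∀ {v} → free v ≡ true → reach t v ≡ true) →
                              card free ≡ card (λ v → free v ∧ reach t v)
  card-free≡card-free-reach t reached = sum-cong-≗ term
    where
    term : ∀ v → ⟦ free v ⟧ ≡ ⟦ free v ∧ reach t v ⟧
    term v with free v in fv
    ... | false = refl
    ... | true = cong ⟦_⟧ (sym (reached fv))

  -- Split by the parity of k: for k = 2h + 2 the top layer h is counted through its two edges into reach h.
  2card-free≤ : 2 ≤ k → 2 * card free ≤ (k ∸ 1) * edges G free blocking
  2card-free≤ 2≤k with even-or-odd (k ∸ 1)
  ... | h , inj₁ k∸1≡2h = begin
    2 * card free                            ≡⟨ cong (2 *_) (card-free≡card-free-reach h (free⇒reached 2≤k h k≤)) ⟩
    2 * card (λ v → free v ∧ reach h v)      ≤⟨ *-monoʳ-≤ 2 (card-free-reach≤ h) ⟩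
    2 * (h * eS)                             ≡⟨ sym (*-assoc 2 h eS) ⟩
    2 * h * eS                               ≡⟨ cong (λ x → (h + x) * eS) (+-identityʳ h) ⟩
    (h + h) * eS                             ≡⟨ cong (_* eS) (sym k∸1≡2h) ⟩
    (k ∸ 1) * eS                             ∎
    where
    open ≤-Reasoning
    eS = edges G free blocking
    k≤ : k ≤ suc (h + h)
    k≤ = ≤-reflexive (trans (sym (m+[n∸m]≡n (≤-trans (s≤s z≤n) 2≤k))) (cong suc k∸1≡2h))
  ... | h , inj₂ k∸1≡2h+1 = begin
    2 * card free                                              ≡⟨ cong (2 *_) (trans (card-free≡card-free-reach (suc h) (free⇒reached 2≤k (suc h) k≤′)) (card-free-reach-suc h)) ⟩
    2 * (card (λ v → free v ∧ reach h v) + card (layer h))     ≡⟨ *-distribˡ-+ 2 (card (λ v → free v ∧ reach h v)) (card (layer h)) ⟩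
    2 * card (λ v → free v ∧ reach h v) + 2 * card (layer h)   ≤⟨ +-mono-≤ (*-monoʳ-≤ 2 (card-free-reach≤ h))
                                                                           (≤-trans (2card-top-layer≤edges h k≤) (edges-layer≤edges-free-blocking h)) ⟩
    2 * (h * eS) + eS                                          ≡⟨ cong (_+ eS) (trans (sym (*-assoc 2 h eS)) (cong (λ x → (h + x) * eS) (+-identityʳ h))) ⟩
    (h + h) * eS + eS                                          ≡⟨ +-comm ((h + h) * eS) eS ⟩
    suc (h + h) * eS                                           ≡⟨ cong (_* eS) (sym k∸1≡2h+1) ⟩
    (k ∸ 1) * eS                                               ∎
    where
    open ≤-Reasoning
    eS = edges G free blocking
    k≤ : k ≤ 2 + (h + h)
    k≤ = ≤-reflexive (trans (sym (m+[n∸m]≡n (≤-trans (s≤s z≤n) 2≤k))) (cong suc k∸1≡2h+1))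
    k≤′ : k ≤ suc (suc h + suc h)
    k≤′ = ≤-trans k≤ (s≤s (≤-trans (n≤1+n _) (≤-reflexive (cong suc (sym (+-suc h h))))))

  blocking-degrees : ℕ
  blocking-degrees = ∑[ v < n ] (⟦ blocking v ⟧ * degree G v)

  edges-free-blocking≤ : edges G free blocking ≤ blocking-degrees
  edges-free-blocking≤ = begin
    edges G free blocking  ≡⟨ edges-comm G free blocking ⟩
    edges G blocking free  ≤⟨ sum-mono-≤ term ⟩
    blocking-degrees       ∎
    where
    open ≤-Reasoning
    term : ∀ v → ∑[ u < n ] ⟦ blocking v ∧ free u ∧ adj G v u ⟧ ≤ ⟦ blocking v ⟧ * degree G v
    term v with blocking v
    ... | false = ≤-reflexive (trans (sum-const n 0) (*-zeroʳ n))
    ... | true = begin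
      degreeIn G free v          ≤⟨ sum-mono-≤ (λ u → ⟦x∧y⟧≤⟦y⟧ (free u) (adj G v u)) ⟩
      degreeIn G (λ _ → true) v  ≡⟨ sym (degree≡degreeIn-all G v) ⟩
      degree G v                 ≡⟨ sym (*-identityˡ _) ⟩
      1 * degree G v             ∎

  -- Summed over all vertices, the terms k₁ · deg of the blocking vertices absorb 2 · #free.
  vertex-bound : ∀ k₁ v → 2 + 2 * (2 + 3 * k₁) + k₁ * (⟦ blocking v ⟧ * degree G v) ≤
                          4 * suc k₁ * ⟦ lookup P v ⟧ + (2 + 3 * k₁) * weight (degree G v) + 2 * ⟦ free v ⟧
  vertex-bound k₁ v with lookup P v in Pv | degree G v in d
  ... | true | zero = isolated-in-P k₁
  ... | true | suc d = vertex-in-P k₁ d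
  ... | false | suc (suc (suc d)) = vertex-branching k₁ d
  ... | false | 2 = vertex-free k₁
  ... | false | 0 = contradiction (trans (sym ([]=⇒lookup (proj₁ cover v (subst (_≤ 1) (sym d) z≤n)))) Pv) λ ()
  ... | false | 1 = contradiction (trans (sym ([]=⇒lookup (proj₁ cover v (≤-reflexive d)))) Pv) λ ()

  total-weight : ℕ
  total-weight = ∑[ v < n ] weight (degree G v)

  summed-vertex-bound : ∀ k₁ → n * (2 + 2 * (2 + 3 * k₁)) + k₁ * blocking-degrees ≤
                               4 * suc k₁ * ∣ P ∣ + (2 + 3 * k₁) * total-weight + 2 * card free
  summed-vertex-bound k₁ = begin
    n * c + k₁ * blocking-degrees
      ≡⟨ cong₂ _+_ (sym (sum-const n c)) (*-distribˡ-sum k₁ (λ v → ⟦ blocking v ⟧ * degree G v)) ⟩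
    ∑[ v < n ] c + ∑[ v < n ] (k₁ * (⟦ blocking v ⟧ * degree G v))
      ≡⟨ sym (∑-distrib-+ (λ _ → c) (λ v → k₁ * (⟦ blocking v ⟧ * degree G v))) ⟩
    ∑[ v < n ] (c + k₁ * (⟦ blocking v ⟧ * degree G v))
      ≤⟨ sum-mono-≤ (vertex-bound k₁) ⟩
    ∑[ v < n ] (a * ⟦ lookup P v ⟧ + L * weight (degree G v) + 2 * ⟦ free v ⟧)
      ≡⟨ ∑-distrib-+ (λ v → a * ⟦ lookup P v ⟧ + L * weight (degree G v)) (λ v → 2 * ⟦ free v ⟧) ⟩
    ∑[ v < n ] (a * ⟦ lookup P v ⟧ + L * weight (degree G v)) + ∑[ v < n ] (2 * ⟦ free v ⟧)
      ≡⟨ cong (_+ ∑[ v < n ] (2 * ⟦ free v ⟧)) (∑-distrib-+ (λ v → a * ⟦ lookup P v ⟧) (λ v → L * weight (degree G v))) ⟩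
    ∑[ v < n ] (a * ⟦ lookup P v ⟧) + ∑[ v < n ] (L * weight (degree G v)) + ∑[ v < n ] (2 * ⟦ free v ⟧)
      ≡⟨ sym (cong₂ _+_ (cong₂ _+_ (*-distribˡ-sum a (λ v → ⟦ lookup P v ⟧)) (*-distribˡ-sum L (λ v → weight (degree G v))))
                                  (*-distribˡ-sum 2 (λ v → ⟦ free v ⟧))) ⟩
    a * ∑[ v < n ] ⟦ lookup P v ⟧ + L * total-weight + 2 * card free
      ≡⟨ cong (λ p → a * p + L * total-weight + 2 * card free) (sym (∣p∣≡∑⟦p⟧ P)) ⟩
    a * ∣ P ∣ + L * total-weight + 2 * card free ∎
    where
    open ≤-Reasoning
    L = 2 + 3 * k₁
    c = 2 + 2 * L
    a = 4 * suc k₁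

  total-weight+2≤2n : ∀ {u v} → Adj G u v → total-weight + 2 ≤ 2 * n
  total-weight+2≤2n uv = subst₂ (λ w c → w + 2 ≤ 2 * c) weight≡ card≡
                           (weightIn+2≤2card G forest _ (λ _ → true) refl refl (uv , refl))
    where
    weight≡ : weightIn G (λ _ → true) ≡ total-weight
    weight≡ = sum-cong-≗ λ v → trans (*-identityˡ _) (cong weight (sym (degree≡degreeIn-all G v)))
    card≡ : card {n} (λ _ → true) ≡ n
    card≡ = trans (sum-const n 1) (*-identityʳ n)

  lower-bound-with-edge : 2 ≤ k → ∀ k₁ → k ≡ suc k₁ → ∀ {u v} → Adj G u v → n + (2 + 3 * k₁) ≤ 2 * suc k₁ * ∣ P ∣
  lower-bound-with-edge 2≤k k₁ k≡ uv = *-cancelˡ-≤ 2 (+-cancelʳ-≤ (L * (2 * n)) _ _ (begin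
    2 * (n + L) + L * (2 * n)                 ≡⟨ rearrange n L ⟩
    n * (2 + 2 * L) + L * 2                   ≤⟨ +-monoˡ-≤ (L * 2) without-free ⟩
    a * ∣ P ∣ + L * total-weight + L * 2      ≡⟨ trans (+-assoc (a * ∣ P ∣) (L * total-weight) (L * 2)) (cong (a * ∣ P ∣ +_) (sym (*-distribˡ-+ L total-weight 2))) ⟩
    a * ∣ P ∣ + L * (total-weight + 2)        ≤⟨ +-monoʳ-≤ (a * ∣ P ∣) (*-monoʳ-≤ L (total-weight+2≤2n uv)) ⟩
    a * ∣ P ∣ + L * (2 * n)                   ≡⟨ cong (_+ L * (2 * n)) (trans (cong (_* ∣ P ∣) (*-assoc 2 2 (suc k₁))) (*-assoc 2 (2 * suc k₁) ∣ P ∣)) ⟩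
    2 * (2 * suc k₁ * ∣ P ∣) + L * (2 * n)    ∎))
    where
    open ≤-Reasoning
    L = 2 + 3 * k₁
    a = 4 * suc k₁
    rearrange : ∀ n L → 2 * (n + L) + L * (2 * n) ≡ n * (2 + 2 * L) + L * 2
    rearrange = solve-∀
    2free≤ : 2 * card free ≤ k₁ * blocking-degrees
    2free≤ = ≤-trans (subst (λ k′ → 2 * card free ≤ (k′ ∸ 1) * edges G free blocking) k≡ (2card-free≤ 2≤k))
                     (*-monoʳ-≤ k₁ edges-free-blocking≤)
    without-free : n * (2 + 2 * L) ≤ a * ∣ P ∣ + L * total-weight
    without-free = +-cancelʳ-≤ (k₁ * blocking-degrees) _ _
      (≤-trans (summed-vertex-bound k₁) (+-monoʳ-≤ (a * ∣ P ∣ + L * total-weight) 2free≤))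

lower-bound : ∀ {n} (G : Graph n) → IsForest G → ∀ k → 2 ≤ k → 2 ≤ n →
              ∀ P → IsBranchingPathCover G k P → n + 3 * k ∸ 1 ≤ 2 * k * ∣ P ∣
lower-bound {n} G forest (suc k₁) 2≤k 2≤n P cover with any? (λ v → 0 <? degree G v)
... | yes (v , 0<d) = subst (_≤ 2 * suc k₁ * ∣ P ∣) (sym (n+3k∸1≡ n k₁))
                        (lower-bound-with-edge G forest (suc k₁) P cover 2≤k k₁ refl (proj₁ (proj₂ neighbour)))
  where neighbour = 0<degreeIn⇒AdjIn G _ (subst (0 <_) (degree≡degreeIn-all G v) 0<d)
... | no edgeless = begin
  n + 3 * suc k₁ ∸ 1  ≡⟨ n+3k∸1≡ n k₁ ⟩
  n + (2 + 3 * k₁)    ≤⟨ n+3k-1≤2kn n k₁ 2≤n ⟩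
  2 * suc k₁ * n      ≤⟨ *-monoʳ-≤ (2 * suc k₁) all-in-P ⟩
  2 * suc k₁ * ∣ P ∣  ∎
  where
  open ≤-Reasoning
  all-in-P : n ≤ ∣ P ∣
  all-in-P = subst (_≤ ∣ P ∣) (∣⊤∣≡n n) (p⊆q⇒∣p∣≤∣q∣ {p = ⊤} λ {v} _ →
               proj₁ cover v (≤-trans (≮⇒≥ λ 0<d → edgeless (v , 0<d)) z≤n))
  n+3k-1≤2kn : ∀ n k₁ → 2 ≤ n → n + (2 + 3 * k₁) ≤ 2 * suc k₁ * n
  n+3k-1≤2kn (suc (suc m)) k₁ (s≤s (s≤s z≤n)) = ≤-by (m + k₁ + 2 * k₁ * m) (solve (m ∷ k₁ ∷ []))

-- The extremal caterpillars

argmax : ∀ {m} (f : Fin (suc m) → ℕ) → ∃ λ i → ∀ j → f j ≤ f i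
argmax {zero} f = zero , λ { zero → ≤-refl }
argmax {suc m} f with argmax (λ i → f (suc i))
... | i , max with f zero ≤? f (suc i)
...   | yes f0≤ = suc i , λ { zero → f0≤ ; (suc j) → max j }
...   | no f0≰ = zero , λ { zero → ≤-refl ; (suc j) → ≤-trans (max j) (<⇒≤ (≰⇒> f0≰)) }

cycle-neighbours : ∀ {n} (G : Graph n) {m p} → IsCycle G m p → ∀ i →
                   ∃₂ λ a b → a ≢ b × Adj G (p i) (p a) × Adj G (p i) (p b)
cycle-neighbours G {zero} (() , _)
cycle-neighbours G {1} (s≤s () , _)
cycle-neighbours G {2} (s≤s (s≤s ()) , _)
cycle-neighbours G {suc (suc (suc m))} {p} (_ , (_ , consecutive) , closing) i with toℕ i in i≡
... | zero = suc zero , lastᵢ , (λ eq → 1≢ (trans (cong toℕ eq) (toℕ-fromℕ< m+2<m+3))) ,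
             consecutive i (suc zero) (cong suc (sym i≡)) ,
             Adj-sym G (closing lastᵢ i (cong suc (toℕ-fromℕ< m+2<m+3)) i≡)
  where
  m+2<m+3 = n<1+n (suc (suc m))
  lastᵢ = fromℕ< m+2<m+3
  1≢ : 1 ≢ suc (suc m)
  1≢ ()
... | suc j = prev , next , prev≢next , Adj-sym G (consecutive prev i (trans i≡ (cong suc (sym (toℕ-fromℕ< j<m))))) , i→next
  where
  j<m : j < suc (suc (suc m))
  j<m = <-trans (n<1+n j) (subst (_< suc (suc (suc m))) i≡ (toℕ<n i))
  prev = fromℕ< j<m
  successor : ∃ λ b → Adj G (p i) (p b) × (toℕ b ≡ suc (suc j) ⊎ (toℕ b ≡ 0 × suc (suc j) ≡ suc (suc (suc m))))
  successor with suc (suc j) <? suc (suc (suc m))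
  ... | yes j+2<m = fromℕ< j+2<m , consecutive i (fromℕ< j+2<m) (trans (toℕ-fromℕ< j+2<m) (cong suc (sym i≡))) , inj₁ (toℕ-fromℕ< j+2<m)
  ... | no j+2≮m = zero , closing i zero (trans (cong suc i≡) i+1≡m) refl , inj₂ (refl , i+1≡m)
    where
    i+1≡m : suc (suc j) ≡ suc (suc (suc m))
    i+1≡m = ≤-antisym (subst (_≤ suc (suc (suc m))) (cong suc i≡) (toℕ<n i)) (≮⇒≥ j+2≮m)
  next = proj₁ successor
  i→next = proj₁ (proj₂ successor)
  prev≢next : prev ≢ next
  prev≢next eq with proj₂ (proj₂ successor)
  ... | inj₁ next≡j+2 = contradiction (trans (sym (toℕ-fromℕ< j<m)) (trans (cong toℕ eq) next≡j+2)) (j≢j+2 j)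
    where
    j≢j+2 : ∀ j → j ≢ suc (suc j)
    j≢j+2 zero ()
    j≢j+2 (suc j) eq = j≢j+2 j (suc-injective eq)
  ... | inj₂ (next≡0 , j+2≡m) = contradiction (trans (sym (toℕ-fromℕ< j<m)) (trans (cong toℕ eq) next≡0))
                                  (λ j≡0 → contradiction (trans (cong (λ x → suc (suc x)) (sym j≡0)) j+2≡m) 2≢3+m)
    where
    2≢3+m : 2 ≢ suc (suc (suc m))
    2≢3+m ()

module ParentGraph (N : ℕ) (par : ℕ → ℕ) (par< : ∀ {a} → 0 < a → par a < a) where

  isChildOf : ℕ → ℕ → Bool
  isChildOf a b = does (0 <? a) ∧ does (par a ≟ b)

  not-own-child : ∀ a → isChildOf a a ≡ false
  not-own-child zero = refl
  not-own-child a@(suc _) = dec-false (par a ≟ a) (<⇒≢ (par< (s≤s z≤n)))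

  parentGraph : Graph N
  parentGraph = record
    { adj = λ u v → isChildOf (toℕ u) (toℕ v) ∨ isChildOf (toℕ v) (toℕ u)
    ; adj-sym = λ u v → ∨-comm (isChildOf (toℕ u) (toℕ v)) _
    ; adj-irrefl = λ v → cong₂ _∨_ (not-own-child (toℕ v)) (not-own-child (toℕ v)) }

  ChildOf : Fin N → Fin N → Set
  ChildOf u v = 0 < toℕ u × par (toℕ u) ≡ toℕ v

  ChildOf⇒Adj : ∀ {u v} → ChildOf u v → Adj parentGraph u v
  ChildOf⇒Adj {u} {v} (0<u , pu≡v)
    rewrite dec-true (0 <? toℕ u) 0<u | dec-true (par (toℕ u) ≟ toℕ v) pu≡v = refl

  isChildOf⇒ : ∀ {a b} → isChildOf a b ≡ true → 0 < a × par a ≡ b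
  isChildOf⇒ {a} {b} c = does⇒ (0 <? a) (proj₁ ∧-conical _ _ c) , does⇒ (par a ≟ b) (proj₂ ∧-conical _ _ c)

  Adj⇒ChildOf : ∀ {u v} → Adj parentGraph u v → ChildOf u v ⊎ ChildOf v u
  Adj⇒ChildOf {u} {v} uv with isChildOf (toℕ u) (toℕ v) in c
  ... | true = inj₁ (isChildOf⇒ c)
  ... | false = inj₂ (isChildOf⇒ uv)

  -- The largest vertex of a cycle would have both cycle neighbours as its parent.
  parentGraph-IsForest : IsForest parentGraph
  parentGraph-IsForest zero p (() , _)
  parentGraph-IsForest (suc m) p cycle@(_ , (injective , _) , _) =
    a≢b (injective (toℕ-injective (trans (sym (parent a ia)) (parent b ib))))
    where
    top = argmax (λ j → toℕ (p j))
    i = proj₁ top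
    a = proj₁ (cycle-neighbours parentGraph cycle i)
    b = proj₁ (proj₂ (cycle-neighbours parentGraph cycle i))
    a≢b = proj₁ (proj₂ (proj₂ (cycle-neighbours parentGraph cycle i)))
    ia = proj₁ (proj₂ (proj₂ (proj₂ (cycle-neighbours parentGraph cycle i))))
    ib = proj₂ (proj₂ (proj₂ (proj₂ (cycle-neighbours parentGraph cycle i))))
    parent : ∀ c → Adj parentGraph (p i) (p c) → par (toℕ (p i)) ≡ toℕ (p c)
    parent c ic with Adj⇒ChildOf ic
    ... | inj₁ (_ , eq) = eq
    ... | inj₂ (0<c , pc≡i) = contradiction (proj₂ top c)
                                (<⇒≱ (subst (_< toℕ (p c)) pc≡i (par< 0<c)))

window-multiple : ∀ k₁ c → ∃ λ t → t < suc k₁ × suc k₁ ∣ c + t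
window-multiple k₁ zero = 0 , s≤s z≤n , (suc k₁ ∣0)
window-multiple k₁ (suc c) with window-multiple k₁ c
... | suc t , t<k , k∣c+t = t , <-trans (n<1+n t) t<k , subst (suc k₁ ∣_) (+-suc c t) k∣c+t
... | zero , _ , k∣c+0 = k₁ , ≤-refl , subst (suc k₁ ∣_) (+-suc c k₁)
                                          (∣m∣n⇒∣m+n (subst (suc k₁ ∣_) (+-identityʳ c) k∣c+0) ∣-refl)

-- w 0, …, w k₁ moves by ±1 and never immediately returns, so it runs through k₁ + 1 consecutive numbers.
module UnitWalk (k₁ : ℕ) (w : ℕ → ℕ)
                (unit-step : ∀ t → t < k₁ → w (suc t) ≡ suc (w t) ⊎ w t ≡ suc (w (suc t)))
                (nonreturning : ∀ t → suc t < k₁ → w (suc (suc t)) ≢ w t) where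

  Up Down : ℕ → Set
  Up t = w (suc t) ≡ suc (w t)
  Down t = w t ≡ suc (w (suc t))

  up-persists : ∀ t → suc t < k₁ → Up t → Up (suc t)
  up-persists t t+1<k₁ up with unit-step (suc t) t+1<k₁
  ... | inj₁ up′ = up′
  ... | inj₂ down′ = contradiction (suc-injective (trans (sym down′) up)) (nonreturning t t+1<k₁)

  down-persists : ∀ t → suc t < k₁ → Down t → Down (suc t)
  down-persists t t+1<k₁ down with unit-step (suc t) t+1<k₁
  ... | inj₂ down′ = down′
  ... | inj₁ up′ = contradiction (trans up′ (sym down)) (nonreturning t t+1<k₁)

  ascending : Up 0 → ∀ d → d ≤ k₁ → w d ≡ w 0 + d
  ascending up zero _ = sym (+-identityʳ (w 0))
  ascending up (suc d) d<k₁ = trans (all-up d d<k₁) (trans (cong suc (ascending up d (<⇒≤ d<k₁))) (sym (+-suc (w 0) d)))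
    where
    all-up : ∀ t → t < k₁ → Up t
    all-up zero _ = up
    all-up (suc t) t+1<k₁ = up-persists t t+1<k₁ (all-up t (<-trans (n<1+n t) t+1<k₁))

  descending : Down 0 → ∀ d → d ≤ k₁ → w d + d ≡ w 0
  descending down zero _ = +-identityʳ (w 0)
  descending down (suc d) d<k₁ = trans (trans (+-suc (w (suc d)) d) (cong (_+ d) (sym (all-down d d<k₁)))) (descending down d (<⇒≤ d<k₁))
    where
    all-down : ∀ t → t < k₁ → Down t
    all-down zero _ = down
    all-down (suc t) t+1<k₁ = down-persists t t+1<k₁ (all-down t (<-trans (n<1+n t) t+1<k₁))

  hits-multiple : ∃ λ t → t ≤ k₁ × suc k₁ ∣ w t
  hits-multiple with k₁ ≟ 0
  ... | yes k₁≡0 = 0 , z≤n , subst (_∣ w 0) (cong suc (sym k₁≡0)) (1∣ w 0)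
  ... | no k₁≢0 with unit-step 0 (n≢0⇒n>0 k₁≢0)
  ...   | inj₁ up = let t , t<k , k∣ = window-multiple k₁ (w 0) in
                    t , s≤s⁻¹ t<k , subst (suc k₁ ∣_) (sym (ascending up t (s≤s⁻¹ t<k))) k∣
  ...   | inj₂ down = let s , s<k , k∣ = window-multiple k₁ (w k₁) in
                      k₁ ∸ s , m∸n≤m k₁ s , subst (suc k₁ ∣_) (from-end s (s≤s⁻¹ s<k)) k∣
    where
    from-end : ∀ s → s ≤ k₁ → w k₁ + s ≡ w (k₁ ∸ s)
    from-end s s≤k₁ = +-cancelʳ-≡ (k₁ ∸ s) _ _ (begin
      w k₁ + s + (k₁ ∸ s)       ≡⟨ +-assoc (w k₁) s (k₁ ∸ s) ⟩
      w k₁ + (s + (k₁ ∸ s))     ≡⟨ cong (w k₁ +_) (m+[n∸m]≡n s≤k₁) ⟩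
      w k₁ + k₁                 ≡⟨ descending down k₁ ≤-refl ⟩
      w 0                       ≡⟨ sym (descending down (k₁ ∸ s) (m∸n≤m k₁ s)) ⟩
      w (k₁ ∸ s) + (k₁ ∸ s)     ∎)
      where open ≡-Reasoning

count : ∀ {p} {P : ℕ → Set p} → Decidable P → ℕ → ℕ
count P? m = ∑[ v < m ] ⟦ does (P? (toℕ v)) ⟧

module _ {p q} {P : ℕ → Set p} {Q : ℕ → Set q} (P? : Decidable P) (Q? : Decidable Q) where

  count-cong : ∀ m → (∀ a → a < m → P a → Q a) → (∀ a → a < m → Q a → P a) → count P? m ≡ count Q? m
  count-cong m P⇒Q Q⇒P = sum-cong-≗ λ v → same-answer (P⇒Q (toℕ v) (toℕ<n v)) (Q⇒P (toℕ v) (toℕ<n v))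
    where
    same-answer : ∀ {a} → (P a → Q a) → (Q a → P a) → ⟦ does (P? a) ⟧ ≡ ⟦ does (Q? a) ⟧
    same-answer {a} P⇒Q Q⇒P with P? a | Q? a
    ... | yes _ | yes _ = refl
    ... | no _ | no _ = refl
    ... | yes pa | no ¬qa = contradiction (P⇒Q pa) ¬qa
    ... | no ¬pa | yes qa = contradiction (Q⇒P qa) ¬pa

count-+ : ∀ {p} {P : ℕ → Set p} (P? : Decidable P) m n → count P? (m + n) ≡ count P? m + count (λ a → P? (m + a)) n
count-+ P? zero n = refl
count-+ P? (suc m) n = trans (cong (⟦ does (P? 0) ⟧ +_) (count-+ (λ a → P? (suc a)) m n))
                             (sym (+-assoc ⟦ does (P? 0) ⟧ _ _))

module _ {p} {P : ℕ → Set p} (P? : Decidable P) where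

  count-none : ∀ m → (∀ a → a < m → ¬ P a) → count P? m ≡ 0
  count-none m none = trans (sum-cong-≗ λ v → cong ⟦_⟧ (dec-false (P? (toℕ v)) (none (toℕ v) (toℕ<n v))))
                            (trans (sum-const m 0) (*-zeroʳ m))

  count-snoc : ∀ m → count P? (suc m) ≡ count P? m + ⟦ does (P? m) ⟧
  count-snoc m = trans (sum-init-last {m} (λ v → ⟦ does (P? (toℕ v)) ⟧))
                       (cong₂ _+_ (sum-cong-≗ {m} {λ v → ⟦ does (P? (toℕ (inject₁ v))) ⟧} λ v → cong (λ a → ⟦ does (P? a) ⟧) (toℕ-inject₁ v))
                                  (cong (λ a → ⟦ does (P? a) ⟧) (toℕ-fromℕ m)))

-- Every block of k numbers 1 + bk, …, (b+1)k contains one multiple of k.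
count-multiples : ∀ k₁ m → count (λ a → suc k₁ ∣? suc a) (m * suc k₁) ≡ m
count-multiples k₁ zero = refl
count-multiples k₁ (suc m) = begin
  count (λ a → k ∣? suc a) (k + m * k)                                ≡⟨ count-+ (λ a → k ∣? suc a) k (m * k) ⟩
  count (λ a → k ∣? suc a) k + count (λ a → k ∣? suc (k + a)) (m * k) ≡⟨ cong₂ _+_ first-block rest ⟩
  1 + m                                                               ∎
  where
  open ≡-Reasoning
  k = suc k₁
  first-block : count (λ a → k ∣? suc a) k ≡ 1
  first-block = begin
    count (λ a → k ∣? suc a) k                            ≡⟨ count-snoc (λ a → k ∣? suc a) k₁ ⟩
    count (λ a → k ∣? suc a) k₁ + ⟦ does (k ∣? k) ⟧       ≡⟨ cong₂ _+_ (count-none (λ a → k ∣? suc a) k₁ λ a a<k₁ k∣ → <⇒≱ (s≤s a<k₁) (∣⇒≤ k∣))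
                                                                       (cong ⟦_⟧ (dec-true (k ∣? k) ∣-refl)) ⟩
    1                                                     ∎
  rest : count (λ a → k ∣? suc (k + a)) (m * k) ≡ m
  rest = trans (count-cong (λ a → k ∣? suc (k + a)) (λ a → k ∣? suc a) (m * k)
                 (λ a _ k∣ → ∣m+n∣m⇒∣n (subst (k ∣_) (sym (+-suc k a)) k∣) ∣-refl)
                 (λ a _ k∣ → subst (k ∣_) (+-suc k a) (∣m∣n⇒∣m+n ∣-refl k∣)))
               (count-multiples k₁ m)

-- For k = 1 + k₁: the spine 0 – 1 – ⋯ – (r+1)k with, for 1 ≤ x ≤ r, a leg (r+x)k + 1 – ⋯ – (r+x+1)k hanging from xk.
-- The multiples of k are the leaves and the branching vertices, and every edge avoiding them joins consecutive numbers.
module Caterpillar (k₁ r : ℕ) where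

  k : ℕ
  k = suc k₁

  N : ℕ
  N = suc (suc (r + r) * k)

  spine-end : ℕ
  spine-end = suc r * k

  LegStart : ℕ → Set
  LegStart a = spine-end < a × k ∣ pred a

  parent : ℕ → ℕ
  parent a = if does (spine-end <? a ×-dec k ∣? pred a) then pred a ∸ r * k else pred a

  parent-legStart : ∀ {a} → LegStart a → parent a ≡ pred a ∸ r * k
  parent-legStart {a} ls rewrite dec-true (spine-end <? a ×-dec k ∣? pred a) ls = refl

  parent-spine : ∀ {a} → ¬ LegStart a → parent a ≡ pred a
  parent-spine {a} ¬ls rewrite dec-false (spine-end <? a ×-dec k ∣? pred a) ¬ls = refl

  parent< : ∀ {a} → 0 < a → parent a < a
  parent< {suc a} _ with spine-end <? suc a ×-dec k ∣? a
  ... | yes ls = subst (_< suc a) (sym (parent-legStart ls)) (s≤s (m∸n≤m a (r * k)))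
  ... | no ¬ls = subst (_< suc a) (sym (parent-spine ¬ls)) ≤-refl

  open ParentGraph N parent parent< public

  legStart-parent-multiple : ∀ {a} → LegStart a → k ∣ parent a
  legStart-parent-multiple {suc a} ls@(end<a , k∣a) = subst (k ∣_) (sym (parent-legStart ls))
    (∣m+n∣m⇒∣n (subst (k ∣_) (sym (m+[n∸m]≡n rk≤a)) k∣a) (n∣m*n r))
    where
    rk≤a : r * k ≤ a
    rk≤a = ≤-trans (m≤n+m (r * k) k) (s≤s⁻¹ end<a)

  ChildOf-non-multiple : ∀ {u v} → ChildOf u v → ¬ k ∣ toℕ v → toℕ u ≡ suc (toℕ v)
  ChildOf-non-multiple {u} {v} (0<u , parent-u≡v) k∤v with spine-end <? toℕ u ×-dec k ∣? pred (toℕ u)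
  ... | yes ls = contradiction (subst (k ∣_) parent-u≡v (legStart-parent-multiple ls)) k∤v
  ... | no ¬ls = trans (sym (suc-pred (toℕ u) {{>-nonZero 0<u}})) (cong suc (trans (sym (parent-spine ¬ls)) parent-u≡v))

  -- Read as a sequence of numbers, a k-path avoiding the multiples of k would move by ±1.
  path-meets-multiple : ∀ {p : Fin k → Fin N} → IsPath parentGraph k p → ¬ (∀ i → ¬ k ∣ toℕ (p i))
  path-meets-multiple {p} (injective , consecutive) k∤ =
    let t , t≤k₁ , k∣wt = UnitWalk.hits-multiple k₁ w unit-step nonreturning in
    k∤ (fromℕ< (s≤s t≤k₁)) (subst (k ∣_) (w≡ (s≤s t≤k₁)) k∣wt)
    where
    w : ℕ → ℕ
    w t with t <? k
    ... | yes t<k = toℕ (p (fromℕ< t<k))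
    ... | no _ = 0
    w≡ : ∀ {t} (t<k : t < k) → w t ≡ toℕ (p (fromℕ< t<k))
    w≡ {t} t<k with t <? k
    ... | yes _ = refl
    ... | no t≮k = contradiction t<k t≮k
    unit-step : ∀ t → t < k₁ → w (suc t) ≡ suc (w t) ⊎ w t ≡ suc (w (suc t))
    unit-step t t<k₁ with Adj⇒ChildOf (consecutive (fromℕ< (<-trans t<k₁ ≤-refl)) (fromℕ< (s≤s t<k₁))
                                          (trans (toℕ-fromℕ< (s≤s t<k₁)) (cong suc (sym (toℕ-fromℕ< (<-trans t<k₁ ≤-refl))))))
    ... | inj₁ child = inj₂ (trans (w≡ (<-trans t<k₁ ≤-refl)) (trans (ChildOf-non-multiple child (k∤ _)) (cong suc (sym (w≡ (s≤s t<k₁))))))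
    ... | inj₂ child = inj₁ (trans (w≡ (s≤s t<k₁)) (trans (ChildOf-non-multiple child (k∤ _)) (cong suc (sym (w≡ (<-trans t<k₁ ≤-refl))))))
    nonreturning : ∀ t → suc t < k₁ → w (suc (suc t)) ≢ w t
    nonreturning t t+1<k₁ eq = contradiction (cong toℕ (injective (toℕ-injective (trans (sym (w≡ t+2<k)) (trans eq (w≡ t<k))))))
                                 λ toℕ≡ → t+2≢t (trans (sym (toℕ-fromℕ< t+2<k)) (trans toℕ≡ (toℕ-fromℕ< t<k)))
      where
      t+2<k : suc (suc t) < k
      t+2<k = s≤s t+1<k₁
      t<k : t < k
      t<k = <-trans (n<1+n t) (<-trans t+1<k₁ ≤-refl)
      t+2≢t : suc (suc t) ≢ t
      t+2≢t eq = <-irrefl (sym eq) (<-trans (n<1+n t) (n<1+n (suc t)))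

  parent-Adj : ∀ (u : Fin N) → 0 < toℕ u → ∃ λ v → Adj parentGraph u v × toℕ v ≡ parent (toℕ u)
  parent-Adj u 0<u = fromℕ< p<N , ChildOf⇒Adj (0<u , sym (toℕ-fromℕ< p<N)) , toℕ-fromℕ< p<N
    where p<N = <-trans (parent< 0<u) (toℕ<n u)

  child-Adj : ∀ (u : Fin N) {b} → b < N → 0 < b → parent b ≡ toℕ u → ∃ λ v → Adj parentGraph u v × toℕ v ≡ b
  child-Adj u {b} b<N 0<b pb≡u = fromℕ< b<N , Adj-sym parentGraph {fromℕ< b<N} {u} (ChildOf⇒Adj {fromℕ< b<N} {u} child) , toℕ-fromℕ< b<N
    where
    child : ChildOf (fromℕ< b<N) u
    child = subst (0 <_) (sym (toℕ-fromℕ< b<N)) 0<b , trans (cong parent (toℕ-fromℕ< b<N)) pb≡u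

  InP : ℕ → Set
  InP a = k ∣ a × (a ≡ 0 ⊎ spine-end ≤ a)

  inP? : ∀ a → Dec (InP a)
  inP? a = k ∣? a ×-dec (a ≟ 0 ⊎-dec spine-end ≤? a)

  P : Subset N
  P = tabulate (λ v → does (inP? (toℕ v)))

  InP⇒∈P : ∀ {v} → InP (toℕ v) → v ∈ P
  InP⇒∈P {v} inP = lookup⇒[]= v P (trans (lookup∘tabulate (λ v → does (inP? (toℕ v))) v) (dec-true (inP? (toℕ v)) inP))

  last-InP : InP (suc (r + r) * k)
  last-InP = n∣m*n (suc (r + r)) , inj₂ (*-monoˡ-≤ k (s≤s (m≤m+n r r)))

  -- Outside P, a vertex a has its parent and the child a + 1.
  outside-P⇒2≤degree : ∀ v → ¬ InP (toℕ v) → 2 ≤ degree parentGraph v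
  outside-P⇒2≤degree v ∉P = subst (2 ≤_) (sym (degree≡degreeIn-all parentGraph v))
    (distinct-AdjIn⇒2≤degreeIn parentGraph _ up≢down (proj₁ (proj₂ up) , refl) (proj₁ (proj₂ down) , refl))
    where
    a = toℕ v
    0<a : 0 < a
    0<a = n≢0⇒n>0 λ a≡0 → ∉P (subst (k ∣_) (sym a≡0) (k ∣0) , inj₁ a≡0)
    a+1<N : suc a < N
    a+1<N = s≤s (≤∧≢⇒< (s≤s⁻¹ (toℕ<n v)) λ a≡last → ∉P (subst InP (sym a≡last) last-InP))
    up = parent-Adj v 0<a
    down = child-Adj v a+1<N (s≤s z≤n) (parent-spine λ (end<a+1 , k∣a) → ∉P (k∣a , inj₂ (s≤s⁻¹ end<a+1)))
    up≢down : proj₁ up ≢ proj₁ down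
    up≢down eq = <-irrefl (trans (sym (proj₂ (proj₂ up))) (trans (cong toℕ eq) (proj₂ (proj₂ down))))
                          (<-trans (parent< 0<a) (n<1+n a))

  -- A multiple a = xk with 0 < x ≤ r has its parent, the child a + 1 and the leg child rk + a + 1.
  multiple-outside-P⇒branching : ∀ v → k ∣ toℕ v → ¬ InP (toℕ v) → Branching parentGraph v
  multiple-outside-P⇒branching v k∣a ∉P =
    distinct-Adj⇒3≤degree parentGraph up≢down up≢leg down≢leg
      (proj₁ (proj₂ up)) (proj₁ (proj₂ down)) (proj₁ (proj₂ leg))
    where
    a = toℕ v
    0<a : 0 < a
    0<a = n≢0⇒n>0 λ a≡0 → ∉P (k∣a , inj₁ a≡0)
    a<end : a < spine-end
    a<end = ≰⇒> λ end≤a → ∉P (k∣a , inj₂ end≤a)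
    k≤a : k ≤ a
    k≤a = ∣⇒≤ {{>-nonZero 0<a}} k∣a
    end≤rk+a : spine-end ≤ r * k + a
    end≤rk+a = subst (_≤ r * k + a) (+-comm (r * k) k) (+-monoʳ-≤ (r * k) k≤a)
    a+1<N : suc a < N
    a+1<N = s≤s (<-≤-trans a<end (*-monoˡ-≤ k (s≤s (m≤n+m r r))))
    leg<N : suc (r * k + a) < N
    leg<N = s≤s (<-≤-trans (+-monoʳ-< (r * k) a<end) (≤-reflexive rk+end≡))
      where
      rk+end≡ : r * k + spine-end ≡ suc (r + r) * k
      rk+end≡ = lemma r k
        where
        lemma : ∀ r k → r * k + suc r * k ≡ suc (r + r) * k
        lemma = solve-∀
    up = parent-Adj v 0<a
    down = child-Adj v a+1<N (s≤s z≤n) (parent-spine λ (end<a+1 , _) → <⇒≱ a<end (s≤s⁻¹ end<a+1))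
    leg = child-Adj v leg<N (s≤s z≤n) (trans (parent-legStart (s≤s end≤rk+a , ∣m∣n⇒∣m+n (n∣m*n r) k∣a)) (m+n∸m≡n (r * k) a))
    toℕ-up : toℕ (proj₁ up) < a
    toℕ-up = subst (_< a) (sym (proj₂ (proj₂ up))) (parent< 0<a)
    0<rk : 0 < r * k
    0<rk = +-cancelˡ-< k 0 (r * k) (≤-<-trans (≤-reflexive (+-identityʳ k)) (≤-<-trans k≤a a<end))
    up≢down : proj₁ up ≢ proj₁ down
    up≢down eq = <-irrefl (trans (cong toℕ eq) (proj₂ (proj₂ down))) (<-trans toℕ-up (n<1+n a))
    up≢leg : proj₁ up ≢ proj₁ leg
    up≢leg eq = <-irrefl (trans (cong toℕ eq) (proj₂ (proj₂ leg))) (<-trans toℕ-up (s≤s (m≤n+m a (r * k))))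
    down≢leg : proj₁ down ≢ proj₁ leg
    down≢leg eq = <-irrefl (trans (sym (proj₂ (proj₂ down))) (trans (cong toℕ eq) (proj₂ (proj₂ leg))))
                           (s≤s (subst (_< r * k + a) (+-identityˡ a) (+-monoˡ-< a 0<rk)))

  cover : IsBranchingPathCover parentGraph k P
  cover = leaves-in-P , paths-blocked
    where
    leaves-in-P : ∀ v → degree parentGraph v ≤ 1 → v ∈ P
    leaves-in-P v d≤1 with inP? (toℕ v)
    ... | yes inP = InP⇒∈P inP
    ... | no ∉P = contradiction d≤1 (<⇒≱ (outside-P⇒2≤degree v ∉P))
    paths-blocked : ∀ p → IsPath parentGraph k p → ∃ λ i → Branching parentGraph (p i) ⊎ p i ∈ P
    paths-blocked p path with any? (λ i → k ∣? toℕ (p i))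
    ... | no none = contradiction (λ i k∣ → none (i , k∣)) (path-meets-multiple path)
    ... | yes (i , k∣) with inP? (toℕ (p i))
    ...   | yes inP = i , inj₂ (InP⇒∈P inP)
    ...   | no ∉P = i , inj₁ (multiple-outside-P⇒branching (p i) k∣ ∉P)

  N≡ : suc (r + r) * k ≡ r * k + spine-end
  N≡ = lemma r k
    where
    lemma : ∀ r k → suc (r + r) * k ≡ r * k + suc r * k
    lemma = solve-∀

  -- P consists of 0 and the multiples of k among (r+1)k, …, (2r+1)k.
  ∣P∣≡r+2 : ∣ P ∣ ≡ suc (suc r)
  ∣P∣≡r+2 = begin
    ∣ P ∣                                                       ≡⟨ ∣p∣≡∑⟦p⟧ P ⟩
    ∑[ v < N ] ⟦ lookup P v ⟧                                   ≡⟨ sum-cong-≗ {N} {λ v → ⟦ lookup P v ⟧} (λ v → cong ⟦_⟧ (lookup∘tabulate (λ v → does (inP? (toℕ v))) v)) ⟩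
    ⟦ does (inP? 0) ⟧ + count (λ a → inP? (suc a)) (suc (r + r) * k)
      ≡⟨ cong₂ _+_ (cong ⟦_⟧ (dec-true (inP? 0) (k ∣0 , inj₁ refl))) (cong (count (λ a → inP? (suc a))) N≡) ⟩
    1 + count (λ a → inP? (suc a)) (r * k + spine-end)          ≡⟨ cong suc (count-+ (λ a → inP? (suc a)) (r * k) spine-end) ⟩
    1 + (count (λ a → inP? (suc a)) (r * k) + count (λ a → inP? (suc (r * k + a))) spine-end)
      ≡⟨ cong suc (cong₂ _+_ (count-none (λ a → inP? (suc a)) (r * k) inner-spine) upper-part) ⟩
    suc (suc r)                                                 ∎
    where
    open ≡-Reasoning
    inner-spine : ∀ a → a < r * k → ¬ InP (suc a)
    inner-spine a a<rk (_ , inj₂ end≤a+1) = <⇒≱ (m<n+m (r * k) (s≤s z≤n)) (≤-trans end≤a+1 a<rk)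
    upper-part : count (λ a → inP? (suc (r * k + a))) spine-end ≡ suc r
    upper-part = trans (count-cong (λ a → inP? (suc (r * k + a))) (λ a → k ∣? suc a) spine-end
                          (λ a _ (k∣ , _) → ∣m+n∣m⇒∣n (subst (k ∣_) (sym (+-suc (r * k) a)) k∣) (n∣m*n r))
                          (λ a _ k∣ → subst (k ∣_) (+-suc (r * k) a) (∣m∣n⇒∣m+n (n∣m*n r) k∣) ,
                                      inj₂ (subst (_≤ suc (r * k + a)) (+-comm (r * k) k)
                                              (subst (r * k + k ≤_) (+-suc (r * k) a) (+-monoʳ-≤ (r * k) (∣⇒≤ k∣))))))
                       (count-multiples k₁ (suc r))

caterpillar-order : ∀ k₁ r → Caterpillar.N k₁ r + 3 * suc k₁ ∸ 1 ≡ 2 * suc k₁ * suc (suc r)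
caterpillar-order k₁ r = trans (n+3k∸1≡ (Caterpillar.N k₁ r) k₁) (lemma k₁ r)
  where
  lemma : ∀ k₁ r → suc (suc (r + r) * suc k₁) + (2 + 3 * k₁) ≡ 2 * suc k₁ * suc (suc r)
  lemma = solve-∀

extremal-order : ∀ k₁ n q → 2 ≤ n → n + 3 * suc k₁ ∸ 1 ≡ 2 * suc k₁ * q →
                 ∃ λ r → q ≡ suc (suc r) × n ≡ Caterpillar.N k₁ r
extremal-order k₁ n zero _ eq = contradiction (m+n≡0⇒n≡0 n (trans (sym (n+3k∸1≡ n k₁)) (trans eq (*-zeroʳ (2 * suc k₁))))) λ ()
extremal-order k₁ 1 (suc zero) (s≤s ()) _
extremal-order k₁ n@(suc (suc m)) (suc zero) _ eq =
  contradiction (trans (sym (n+3k∸1≡ n k₁)) (trans eq (*-identityʳ (2 * suc k₁)))) (>⇒≢ too-big)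
  where
  too-big : 2 * suc k₁ < n + (2 + 3 * k₁)
  too-big = subst (2 * suc k₁ <_) (sym (lemma m k₁)) (m≤m+n (suc (2 * suc k₁)) (1 + m + k₁))
    where
    lemma : ∀ m k₁ → suc (suc m) + (2 + 3 * k₁) ≡ suc (2 * suc k₁) + (1 + m + k₁)
    lemma = solve-∀
extremal-order k₁ n (suc (suc r)) _ eq =
  r , refl , +-cancelʳ-≡ (2 + 3 * k₁) n N
    (trans (sym (n+3k∸1≡ n k₁)) (trans eq (trans (sym (caterpillar-order k₁ r)) (n+3k∸1≡ N k₁))))
  where open Caterpillar k₁ r using (N)

caterpillar-extremal : ∀ k₁ r → 1 ≤ k₁ →
                       let open Caterpillar k₁ r in IsForest parentGraph × ψb-≡ parentGraph (suc k₁) (suc (suc r))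
caterpillar-extremal k₁ r 1≤k₁ = parentGraph-IsForest , (P , cover , ∣P∣≡r+2) , minimal
  where
  open Caterpillar k₁ r
  minimal : ψb-≥ parentGraph k (suc (suc r))
  minimal P′ cover′ = *-cancelˡ-≤ (2 * k) (subst (_≤ 2 * k * ∣ P′ ∣) (caterpillar-order k₁ r)
                        (lower-bound parentGraph parentGraph-IsForest k (s≤s 1≤k₁) (s≤s (s≤s z≤n)) P′ cover′))

theorem2 : (k : ℕ) → 2 ≤ k →
    ((n : ℕ) → 2 ≤ n → (F : Graph n) → IsForest F →
      (P : Subset n) → IsBranchingPathCover F k P →
        n + 3 * k ∸ 1 ≤ 2 * k * ∣ P ∣)
    ×
    ((n : ℕ) → 2 ≤ n → (q : ℕ) → n + 3 * k ∸ 1 ≡ 2 * k * q →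
      Σ (Graph n) (λ F → IsForest F × ψb-≡ F k q))
theorem2 k@(suc k₁) 2≤k@(s≤s 1≤k₁) = bound , tight
  where
  bound : (n : ℕ) → 2 ≤ n → (F : Graph n) → IsForest F →
          (P : Subset n) → IsBranchingPathCover F k P → n + 3 * k ∸ 1 ≤ 2 * k * ∣ P ∣
  bound n 2≤n F forest = lower-bound F forest k 2≤k 2≤n
  tight : (n : ℕ) → 2 ≤ n → (q : ℕ) → n + 3 * k ∸ 1 ≡ 2 * k * q → Σ (Graph n) (λ F → IsForest F × ψb-≡ F k q)
  tight n 2≤n q eq with extremal-order k₁ n q 2≤n eq
  ... | r , refl , refl = Caterpillar.parentGraph k₁ r , caterpillar-extremal k₁ r 1≤k₁
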